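{- For $k,n\in\mathbb{N}$, let $\ell(k,n)$ denote the (least) period of the sequence $(S_n(m)\bmod k)_{m\ge 1}$, where $S_n(m)=\sum_{i=1}^m i^n$. Then: (1) $\ell(2,n)=4$ for all $n\in\mathbb{N}$. (2) For $a\ge 2$, $\ell(2^a,n)=2^{a+1}$ if $n=1$ or $2\mid n$, and $\ell(2^a,n)=2^a$ otherwise. (3) For $q$ an odd prime and $a\ge 1$, $$\ell(q^a,n)=\begin{cases} q^{a+1}, & \text{if } q-1\mid n;\\ q^{a-i}, & \text{if } q-1\nmid n,\ \nu_q(n)=i,\ 0\le i\le a-2;\\ q, & \text{if } q-1\nmid n \text{ and } q^{a-1}\mid n,\end{cases}$$ where $\nu_q(n)$ is the exponent of the highest power of $q$ dividing $n$.
   Context: $\mathbb{N}$ denotes the positive integers. $S_n(m)=1^n+2^n+\dots+m^n$. The sequence $(S_n(m)\bmod k)_{m\ge1}$ is periodic (for every $k,n$), and $\ell(k,n)$ is its least period. -}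

module Defs where

open import Data.Nat using (ℕ; zero; suc; _+_; _*_; _^_; _≤_; _%_; NonZero)
open import Relation.Binary.PropositionalEquality using (_≡_)

S : ℕ → ℕ → ℕ
S n zero = 0
S n (suc m) = S n m + suc m ^ n

IsPeriod : (k : ℕ) .{{_ : NonZero k}} → ℕ → ℕ → Set
IsPeriod k n p = 1 ≤ p × (∀ m → 1 ≤ m → S n (m + p) % k ≡ S n m % k)
  where open import Data.Product using (_×_)

IsLeastPeriod : (k : ℕ) .{{_ : NonZero k}} → ℕ → ℕ → Set
IsLeastPeriod k n p = IsPeriod k n p × (∀ r → IsPeriod k n r → p ≤ r)
  where open import Data.Product using (_×_)

module Submission where

-- A number p is a period of m ↦ S n m mod k iff every window (m+1)^n + ⋯ + (m+p)^n vanishes mod k. For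
-- k = q^a the periods are closed under gcd, so the least period is the q^e such that q^e is a period and
-- q^(e-1) is not. A period p is obtained when x ↦ x^n is p-periodic mod k (lifting the exponent) and
-- S n p ≡ 0 (mod k); the latter is computed q-adically from Σ_{j<qN} j^n ≡ q Σ_{j<N} j^n, from Fermat's
-- little theorem when (q-1) ∣ n, and, when (q-1) ∤ n, from multiplying the residues by a unit c with
-- c^n ≢ 1. A non-period p is detected by S n k ≢ 0 (for p = k) or by (1 + p)^n ≢ 1 (mod k), the exact
-- form of lifting the exponent.

module PowerSumPeriods where

  import Algebra.Properties.CommutativeMonoid.Sum as CommutativeMonoidSum
  open import Data.Empty using (⊥-elim)
  open import Data.Fin using (Fin; toℕ; fromℕ<)
  import Data.Fin.Properties as Finₚ
  open import Data.Fin.Permutation using (Permutation′; permutation)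
  open import Data.Integer using (ℤ; +_; -[1+_]; 0ℤ; 1ℤ; _+_; _-_; -_; _*_; _^_; ∣_∣)
  open import Data.Integer.Properties
  import Data.Integer.Divisibility.Signed as ℤ∣
  open import Data.Integer.Tactic.RingSolver using (solve-∀)
  open import Data.Nat as ℕ using (ℕ; zero; suc; NonZero; z≤n; s≤s)
  import Data.Nat.Properties as ℕₚ
  import Data.Nat.Tactic.RingSolver as ℕ-Solver
  open import Data.Nat.Combinatorics using (_C_; nCk+nC[k+1]≡[n+1]C[k+1]; k>n⇒nCk≡0; nCn≡1; nC1≡n; nCk≡nC[n∸k])
  open import Data.Nat.Coprimality using (Coprime; coprime-divisor; coprime-Bézout; gcd≡1⇒coprime) renaming (sym to coprime-sym)
  open import Data.Nat.DivMod using (_%_; _/_; m≡m%n+[m/n]*n; [m+kn]%n≡m%n; m%n<n; m%n%n≡m%n; %-distribˡ-*; m<n⇒m%n≡m)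
  open import Data.Nat.Divisibility
  open import Data.Nat.GCD using (GCD; module Bézout; gcd[m,n]∣m; gcd[m,n]∣n)
  open import Data.Nat.Primality using (Prime; prime; euclidsLemma; prime⇒nonZero; prime⇒irreducible; prime[2])
  open import Data.Product using (∃-syntax; _×_; _,_; proj₁; proj₂)
  open import Data.Sum using (_⊎_; inj₁; inj₂; [_,_]′)
  open import Level using (0ℓ)
  open import Relation.Binary.Bundles using (Setoid)
  import Relation.Binary.Reasoning.Setoid as SetoidReasoning
  open import Relation.Binary.PropositionalEquality
  open import Relation.Nullary using (¬_; Dec; yes; no)
  open import Relation.Nullary.Decidable using (_×-dec_; ¬?)
  open import Defs

  pos-^ : ∀ a n → + (a ℕ.^ n) ≡ (+ a) ^ n
  pos-^ a zero = refl
  pos-^ a (suc n) = trans (pos-* a (a ℕ.^ n)) (cong (+ a *_) (pos-^ a n))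

  ^-distribʳ-* : ∀ x y n → (x * y) ^ n ≡ x ^ n * y ^ n
  ^-distribʳ-* x y zero = refl
  ^-distribʳ-* x y (suc n) = trans (cong (x * y *_) (^-distribʳ-* x y n)) (lemma x y (x ^ n) (y ^ n))
    where lemma : ∀ x y X Y → x * y * (X * Y) ≡ x * X * (y * Y)
          lemma = solve-∀

  infix 4 _≡_mod_

  record _≡_mod_ (x y : ℤ) (M : ℕ) : Set where
    constructor mod-witness
    field
      quotient : ℤ
      equation : x ≡ y + quotient * + M

  module _ {M : ℕ} where

    mod-refl : ∀ {x} → x ≡ x mod M
    mod-refl {x} = mod-witness 0ℤ (lemma x (+ M))
      where lemma : ∀ x m → x ≡ x + 0ℤ * m
            lemma = solve-∀

    mod-reflexive : ∀ {x y} → x ≡ y → x ≡ y mod M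
    mod-reflexive refl = mod-refl

    mod-sym : ∀ {x y} → x ≡ y mod M → y ≡ x mod M
    mod-sym {x} {y} (mod-witness c refl) = mod-witness (- c) (lemma y c (+ M))
      where lemma : ∀ y c m → y ≡ (y + c * m) + - c * m
            lemma = solve-∀

    mod-trans : ∀ {x y z} → x ≡ y mod M → y ≡ z mod M → x ≡ z mod M
    mod-trans {z = z} (mod-witness c refl) (mod-witness d refl) = mod-witness (c + d) (lemma z d c (+ M))
      where lemma : ∀ z d c m → (z + d * m) + c * m ≡ z + (c + d) * m
            lemma = solve-∀

    mod-+ : ∀ {x y u v} → x ≡ y mod M → u ≡ v mod M → x + u ≡ y + v mod M
    mod-+ {y = y} {v = v} (mod-witness c refl) (mod-witness d refl) = mod-witness (c + d) (lemma y v c d (+ M))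
      where lemma : ∀ y v c d m → (y + c * m) + (v + d * m) ≡ (y + v) + (c + d) * m
            lemma = solve-∀

    mod-* : ∀ {x y u v} → x ≡ y mod M → u ≡ v mod M → x * u ≡ y * v mod M
    mod-* {y = y} {v = v} (mod-witness c refl) (mod-witness d refl) =
      mod-witness (c * v + y * d + c * d * + M) (lemma y v c d (+ M))
      where lemma : ∀ y v c d m → (y + c * m) * (v + d * m) ≡ y * v + (c * v + y * d + c * d * m) * m
            lemma = solve-∀

    mod-^ : ∀ {x y} → x ≡ y mod M → ∀ n → x ^ n ≡ y ^ n mod M
    mod-^ x≡y zero = mod-refl
    mod-^ x≡y (suc n) = mod-* x≡y (mod-^ x≡y n)

    multiple≡0 : ∀ {x} c → x ≡ c * + M → x ≡ 0ℤ mod M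
    multiple≡0 c refl = mod-witness c (sym (+-identityˡ _))

    mod-+-≡0 : ∀ {x y} → y ≡ 0ℤ mod M → x + y ≡ x mod M
    mod-+-≡0 {x} y≡0 = mod-trans (mod-+ (mod-refl {x}) y≡0) (mod-reflexive (+-identityʳ x))

    mod-cancelˡ-+ : ∀ {a b c} → a + b ≡ a + c mod M → b ≡ c mod M
    mod-cancelˡ-+ {a} {b} {c} (mod-witness k eq) =
      mod-witness k (trans (lemma₁ a b) (trans (cong (_- a) eq) (lemma₂ a c (k * + M))))
      where lemma₁ : ∀ a b → b ≡ (a + b) - a
            lemma₁ = solve-∀
            lemma₂ : ∀ a c z → (a + c + z) - a ≡ c + z
            lemma₂ = solve-∀

    mod-difference : ∀ {x y} → x ≡ y mod M → x - y ≡ 0ℤ mod M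
    mod-difference {y = y} (mod-witness c refl) = mod-witness c (lemma y (c * + M))
      where lemma : ∀ y z → y + z - y ≡ 0ℤ + z
            lemma = solve-∀

    difference-mod : ∀ {x y} → x - y ≡ 0ℤ mod M → x ≡ y mod M
    difference-mod {x} {y} (mod-witness c eq) = mod-witness c (trans (lemma x y) (cong (_+_ y) (trans eq (+-identityˡ _))))
      where lemma : ∀ x y → x ≡ y + (x - y)
            lemma = solve-∀

    mod≡0⇒∣ : ∀ {x} → x ≡ 0ℤ mod M → M ∣ ∣ x ∣
    mod≡0⇒∣ (mod-witness c refl) = divides ∣ c ∣ (trans (cong ∣_∣ (+-identityˡ (c * + M))) (abs-* c (+ M)))

    ∣⇒mod≡0 : ∀ {x} → M ∣ ∣ x ∣ → x ≡ 0ℤ mod M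
    ∣⇒mod≡0 {x} M∣x with ℤ∣.∣ᵤ⇒∣ {+ M} {x} M∣x
    ... | ℤ∣.divides c eq = multiple≡0 c eq

    infix 4 _≟_mod
    _≟_mod : ∀ x y → Dec (x ≡ y mod M)
    x ≟ y mod with (+ M) ℤ∣.∣? (x - y)
    ... | yes (ℤ∣.divides c eq) = yes (difference-mod (multiple≡0 c eq))
    ... | no M∤x-y = no λ x≡y → M∤x-y (toSigned (mod-difference x≡y))
      where toSigned : x - y ≡ 0ℤ mod M → (+ M) ℤ∣.∣ (x - y)
            toSigned (mod-witness c eq) = ℤ∣.divides c (trans eq (+-identityˡ _))

  mod-setoid : ℕ → Setoid 0ℓ 0ℓ
  mod-setoid M = record
    { Carrier = ℤ
    ; _≈_ = λ x y → x ≡ y mod M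
    ; isEquivalence = record { refl = mod-refl ; sym = mod-sym ; trans = mod-trans }
    }

  module ModReasoning {M : ℕ} = SetoidReasoning (mod-setoid M)

  mod-∣ : ∀ {M M' x y} → M ∣ M' → x ≡ y mod M' → x ≡ y mod M
  mod-∣ {M} {x = x} {y} (divides d refl) (mod-witness c refl) =
    mod-witness (c * + d) (cong (_+_ y) (trans (cong (c *_) (pos-* d M)) (sym (*-assoc c (+ d) (+ M)))))

  mod-scale : ∀ {M x y} d → x ≡ y mod M → + d * x ≡ + d * y mod d ℕ.* M
  mod-scale {M} {y = y} d (mod-witness c refl) =
    mod-witness c (trans (lemma (+ d) y c (+ M)) (cong (λ z → + d * y + c * z) (sym (pos-* d M))))
    where lemma : ∀ d y c m → d * (y + c * m) ≡ d * y + c * (d * m)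
          lemma = solve-∀

  mod-scaleʳ : ∀ {M x y} d → x ≡ y mod M → + d * x ≡ + d * y mod M ℕ.* d
  mod-scaleʳ {M} {x} {y} d x≡y = subst (λ K → + d * x ≡ + d * y mod K) (ℕₚ.*-comm d M) (mod-scale d x≡y)

  mod-shift : ∀ M x → + (x ℕ.+ M) ≡ + x mod M
  mod-shift M x = mod-witness 1ℤ (trans (pos-+ x M) (cong (_+_ (+ x)) (sym (*-identityˡ (+ M)))))

  module _ (k : ℕ) .{{_ : NonZero k}} where

    private
      division : ∀ a → + a ≡ + (a % k) + + (a / k) * + k
      division a = trans (cong +_ (m≡m%n+[m/n]*n a k)) (trans (pos-+ (a % k) _) (cong (_+_ (+ (a % k))) (pos-* (a / k) k)))

    %≡%⇒mod : ∀ a b → a % k ≡ b % k → + a ≡ + b mod k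
    %≡%⇒mod a b eq = mod-witness (+ (a / k) - + (b / k))
      (trans (division a) (trans (cong (λ r → + r + + (a / k) * + k) eq)
        (trans (lemma (+ (b % k)) (+ (a / k)) (+ (b / k)) (+ k)) (cong (_+ (+ (a / k) - + (b / k)) * + k) (sym (division b))))))
      where lemma : ∀ r A B k → r + A * k ≡ (r + B * k) + (A - B) * k
            lemma = solve-∀

    mod⇒%≡% : ∀ a b → + a ≡ + b mod k → a % k ≡ b % k
    mod⇒%≡% a b (mod-witness (+ c) eq) =
      trans (cong (_% k) (+-injective (trans eq (trans (cong (_+_ (+ b)) (sym (pos-* c k))) (sym (pos-+ b (c ℕ.* k))))))) ([m+kn]%n≡m%n b c k)
    mod⇒%≡% a b (mod-witness -[1+ c ] eq) =
      sym (trans (cong (_% k) (+-injective b≡a+ck)) ([m+kn]%n≡m%n a (suc c) k))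
      where
      lemma : ∀ a b c k → a ≡ b + (- c) * k → b ≡ a + c * k
      lemma _ b c k refl = identity b c k
        where identity : ∀ b c k → b ≡ (b + (- c) * k) + c * k
              identity = solve-∀
      b≡a+ck : + b ≡ + (a ℕ.+ suc c ℕ.* k)
      b≡a+ck = trans (lemma (+ a) (+ b) (+ suc c) (+ k) eq) (trans (cong (_+_ (+ a)) (sym (pos-* (suc c) k))) (sym (pos-+ a (suc c ℕ.* k))))

  prime⇒1≢0 : ∀ {q} → Prime q → ¬ (1ℤ ≡ 0ℤ mod q)
  prime⇒1≢0 {q} q-prime 1≡0 with ∣1⇒≡1 (mod≡0⇒∣ 1≡0)
  prime⇒1≢0 (prime {{()}} _) 1≡0 | refl

  mod≡0-cancelʳ : ∀ {q X} a .{{_ : NonZero X}} → a * + X ≡ 0ℤ mod q ℕ.* X → q ∣ ∣ a ∣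
  mod≡0-cancelʳ {q} {X} a aX≡0 = *-cancelʳ-∣ X (subst (q ℕ.* X ∣_) (abs-* a (+ X)) (mod≡0⇒∣ aX≡0))

  mod-cancelˡ-* : ∀ {M c x y} → Coprime ∣ c ∣ M → c * x ≡ c * y mod M → x ≡ y mod M
  mod-cancelˡ-* {M} {c} {x} {y} coprime cx≡cy =
    difference-mod (∣⇒mod≡0 (coprime-divisor (coprime-sym coprime) (subst (M ∣_) (abs-* c (x - y)) (mod≡0⇒∣ c[x-y]≡0))))
    where
    c[x-y]≡0 : c * (x - y) ≡ 0ℤ mod M
    c[x-y]≡0 = mod-trans (mod-reflexive (lemma c x y)) (mod-difference cx≡cy)
      where lemma : ∀ c x y → c * (x - y) ≡ c * x - c * y
            lemma = solve-∀

  Σ< : ℕ → (ℕ → ℤ) → ℤ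
  Σ< zero f = 0ℤ
  Σ< (suc n) f = Σ< n f + f n

  Σ<-cong : ∀ n {f g : ℕ → ℤ} → (∀ j → f j ≡ g j) → Σ< n f ≡ Σ< n g
  Σ<-cong zero f≡g = refl
  Σ<-cong (suc n) f≡g = cong₂ _+_ (Σ<-cong n f≡g) (f≡g n)

  Σ<-mod-< : ∀ {M} n {f g : ℕ → ℤ} → (∀ j → j ℕ.< n → f j ≡ g j mod M) → Σ< n f ≡ Σ< n g mod M
  Σ<-mod-< zero f≡g = mod-refl
  Σ<-mod-< (suc n) f≡g = mod-+ (Σ<-mod-< n (λ j j<n → f≡g j (ℕₚ.m<n⇒m<1+n j<n))) (f≡g n ℕₚ.≤-refl)

  Σ<-mod : ∀ {M} n {f g : ℕ → ℤ} → (∀ j → f j ≡ g j mod M) → Σ< n f ≡ Σ< n g mod M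
  Σ<-mod n f≡g = Σ<-mod-< n (λ j _ → f≡g j)

  Σ<-+ : ∀ n (f g : ℕ → ℤ) → Σ< n (λ j → f j + g j) ≡ Σ< n f + Σ< n g
  Σ<-+ zero f g = refl
  Σ<-+ (suc n) f g = trans (cong (_+ (f n + g n)) (Σ<-+ n f g)) (lemma (Σ< n f) (Σ< n g) (f n) (g n))
    where lemma : ∀ a b c d → (a + b) + (c + d) ≡ (a + c) + (b + d)
          lemma = solve-∀

  Σ<-*ˡ : ∀ n c (f : ℕ → ℤ) → Σ< n (λ j → c * f j) ≡ c * Σ< n f
  Σ<-*ˡ zero c f = sym (*-zeroʳ c)
  Σ<-*ˡ (suc n) c f = trans (cong (_+ c * f n) (Σ<-*ˡ n c f)) (sym (*-distribˡ-+ c (Σ< n f) (f n)))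

  Σ<-const : ∀ n c → Σ< n (λ _ → c) ≡ + n * c
  Σ<-const zero c = refl
  Σ<-const (suc n) c = trans (cong (_+ c) (Σ<-const n c)) (lemma (+ n) c)
    where lemma : ∀ n c → n * c + c ≡ (+ 1 + n) * c
          lemma = solve-∀

  Σ<-suc : ∀ n (f : ℕ → ℤ) → Σ< (suc n) f ≡ f 0 + Σ< n (λ j → f (suc j))
  Σ<-suc zero f = +-comm 0ℤ (f 0)
  Σ<-suc (suc n) f = trans (cong (_+ f (suc n)) (Σ<-suc n f)) (+-assoc (f 0) _ _)

  Σ<-split : ∀ a b (f : ℕ → ℤ) → Σ< (a ℕ.+ b) f ≡ Σ< a f + Σ< b (λ j → f (a ℕ.+ j))
  Σ<-split a zero f = trans (cong (λ n → Σ< n f) (ℕₚ.+-identityʳ a)) (sym (+-identityʳ _))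
  Σ<-split a (suc b) f = begin
    Σ< (a ℕ.+ suc b) f                                   ≡⟨ cong (λ n → Σ< n f) (ℕₚ.+-suc a b) ⟩
    Σ< (a ℕ.+ b) f + f (a ℕ.+ b)                          ≡⟨ cong (_+ f (a ℕ.+ b)) (Σ<-split a b f) ⟩
    Σ< a f + Σ< b (λ j → f (a ℕ.+ j)) + f (a ℕ.+ b)       ≡⟨ +-assoc (Σ< a f) _ _ ⟩
    Σ< a f + Σ< (suc b) (λ j → f (a ℕ.+ j))               ∎
    where open ≡-Reasoning

  Σ<-swap : ∀ a b (f : ℕ → ℕ → ℤ) → Σ< a (λ i → Σ< b (f i)) ≡ Σ< b (λ j → Σ< a (λ i → f i j))
  Σ<-swap zero b f = sym (trans (Σ<-const b 0ℤ) (*-zeroʳ (+ b)))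
  Σ<-swap (suc a) b f =
    trans (cong (_+ Σ< b (f a)) (Σ<-swap a b f)) (sym (Σ<-+ b (λ j → Σ< a (λ i → f i j)) (f a)))

  Σ<-blocks : ∀ u n (f : ℕ → ℤ) → Σ< (u ℕ.* n) f ≡ Σ< u (λ w → Σ< n (λ j → f (w ℕ.* n ℕ.+ j)))
  Σ<-blocks zero n f = refl
  Σ<-blocks (suc u) n f = begin
    Σ< (n ℕ.+ u ℕ.* n) f
      ≡⟨ Σ<-split n (u ℕ.* n) f ⟩
    Σ< n f + Σ< (u ℕ.* n) (λ j → f (n ℕ.+ j))
      ≡⟨ cong (_+_ (Σ< n f)) (Σ<-blocks u n (λ j → f (n ℕ.+ j))) ⟩
    Σ< n f + Σ< u (λ w → Σ< n (λ j → f (n ℕ.+ (w ℕ.* n ℕ.+ j))))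
      ≡⟨ cong (_+_ (Σ< n f)) (Σ<-cong u (λ w → Σ<-cong n (λ j → cong f (sym (ℕₚ.+-assoc n (w ℕ.* n) j))))) ⟩
    Σ< n f + Σ< u (λ w → Σ< n (λ j → f (suc w ℕ.* n ℕ.+ j)))
      ≡⟨ sym (Σ<-suc u (λ w → Σ< n (λ j → f (w ℕ.* n ℕ.+ j)))) ⟩
    Σ< (suc u) (λ w → Σ< n (λ j → f (w ℕ.* n ℕ.+ j)))
      ∎
    where open ≡-Reasoning

  Σ<-telescope : ∀ N (f : ℕ → ℤ) → Σ< N (λ j → f (suc j) - f j) ≡ f N - f 0
  Σ<-telescope zero f = sym (+-inverseʳ (f 0))
  Σ<-telescope (suc N) f = trans (cong (_+ (f (suc N) - f N)) (Σ<-telescope N f)) (lemma (f 0) (f N) (f (suc N)))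
    where lemma : ∀ a b c → b - a + (c - b) ≡ c - a
          lemma = solve-∀

  powerSum : ℕ → ℕ → ℤ
  powerSum n N = Σ< N (λ j → (+ j) ^ n)

  powerSum-suc : ∀ n N → n ≢ 0 → powerSum n (suc N) ≡ Σ< N (λ j → (+ suc j) ^ n)
  powerSum-suc n N n≢0 = trans (Σ<-suc N (λ j → (+ j) ^ n)) (trans (cong (_+ Σ< N (λ j → (+ suc j) ^ n)) (0^n≡0 n n≢0)) (+-identityˡ (Σ< N (λ j → (+ suc j) ^ n))))
    where
    0^n≡0 : ∀ n → n ≢ 0 → (+ 0) ^ n ≡ 0ℤ
    0^n≡0 zero n≢0 = ⊥-elim (n≢0 refl)
    0^n≡0 (suc n) _ = *-zeroˡ ((+ 0) ^ n)

  triangle : ℕ → ℤ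
  triangle n = Σ< n (λ j → + j)

  triangle*2 : ∀ n → triangle n * + 2 ≡ + n * (+ n - 1ℤ)
  triangle*2 zero = refl
  triangle*2 (suc n) = begin
    (triangle n + + n) * + 2           ≡⟨ *-distribʳ-+ (+ 2) (triangle n) (+ n) ⟩
    triangle n * + 2 + + n * + 2       ≡⟨ cong (_+ + n * + 2) (triangle*2 n) ⟩
    + n * (+ n - 1ℤ) + + n * + 2    ≡⟨ lemma (+ n) ⟩
    (+ 1 + + n) * (+ 1 + + n - 1ℤ)  ≡⟨ cong (λ m → m * (m - 1ℤ)) (sym (pos-+ 1 n)) ⟩
    + suc n * (+ suc n - 1ℤ)        ∎
    where open ≡-Reasoning
          lemma : ∀ n → n * (n - 1ℤ) + n * + 2 ≡ (+ 1 + n) * (+ 1 + n - 1ℤ)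
          lemma = solve-∀

  triangle-odd : ∀ h → triangle (suc (h ℕ.+ h)) ≡ + suc (h ℕ.+ h) * + h
  triangle-odd h = *-cancelʳ-≡ _ _ (+ 2) (begin
    triangle q * + 2                               ≡⟨ triangle*2 q ⟩
    + q * (+ q - 1ℤ)                            ≡⟨ cong (λ m → m * (m - 1ℤ)) q≡2h+1 ⟩
    (+ 1 + (+ h + + h)) * (+ 1 + (+ h + + h) - 1ℤ) ≡⟨ lemma (+ h) ⟩
    (+ 1 + (+ h + + h)) * + h * + 2              ≡⟨ cong (λ m → m * + h * + 2) (sym q≡2h+1) ⟩
    + q * + h * + 2                             ∎)
    where
    open ≡-Reasoning
    q = suc (h ℕ.+ h)
    q≡2h+1 : + q ≡ + 1 + (+ h + + h)
    q≡2h+1 = trans (pos-+ 1 (h ℕ.+ h)) (cong (λ m → + 1 + m) (pos-+ h h))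
    lemma : ∀ h → (+ 1 + (h + h)) * (+ 1 + (h + h) - 1ℤ) ≡ (+ 1 + (h + h)) * h * + 2
    lemma = solve-∀

  Σ<-window-step : ∀ (G : ℕ → ℤ) m p →
    G m + Σ< p (λ j → G (suc m ℕ.+ j)) ≡ Σ< p (λ j → G (m ℕ.+ j)) + G (m ℕ.+ p)
  Σ<-window-step G m p =
    trans (cong₂ _+_ (cong G (sym (ℕₚ.+-identityʳ m))) (Σ<-cong p (λ j → cong G (sym (ℕₚ.+-suc m j)))))
          (sym (Σ<-suc p (λ j → G (m ℕ.+ j))))

  module _ {M N : ℕ} (G : ℕ → ℤ) (periodic : ∀ x → G (x ℕ.+ N) ≡ G x mod M) where

    window-sum-mod : ∀ m → Σ< N (λ j → G (m ℕ.+ j)) ≡ Σ< N G mod M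
    window-sum-mod zero = mod-refl
    window-sum-mod (suc m) = mod-trans (mod-cancelˡ-+ {a = G m} step) (window-sum-mod m)
      where
      step : G m + Σ< N (λ j → G (suc m ℕ.+ j)) ≡ G m + Σ< N (λ j → G (m ℕ.+ j)) mod M
      step = mod-trans (mod-reflexive (Σ<-window-step G m N))
               (mod-trans (mod-+ (mod-refl {x = Σ< N (λ j → G (m ℕ.+ j))}) (periodic m)) (mod-reflexive (+-comm _ (G m))))

    periodic-* : ∀ u x → G (x ℕ.+ u ℕ.* N) ≡ G x mod M
    periodic-* zero x = mod-reflexive (cong G (ℕₚ.+-identityʳ x))
    periodic-* (suc u) x = mod-trans (mod-reflexive (cong G (rearrange x N (u ℕ.* N))))
                                     (mod-trans (periodic (x ℕ.+ u ℕ.* N)) (periodic-* u x))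
      where rearrange : ∀ x n m → x ℕ.+ (n ℕ.+ m) ≡ x ℕ.+ m ℕ.+ n
            rearrange = ℕ-Solver.solve-∀

    window-sum-blocks : ∀ u m → Σ< (u ℕ.* N) (λ j → G (m ℕ.+ j)) ≡ + u * Σ< N G mod M
    window-sum-blocks u m = mod-trans (mod-reflexive (Σ<-blocks u N (λ j → G (m ℕ.+ j))))
      (mod-trans (Σ<-mod u (λ w → mod-trans
          (mod-reflexive (Σ<-cong N (λ j → cong G (sym (ℕₚ.+-assoc m (w ℕ.* N) j)))))
          (window-sum-mod (m ℕ.+ w ℕ.* N))))
        (mod-reflexive (Σ<-const u (Σ< N G))))

  -- Periods of sequences

  infix 4 _HasPeriod_
  _HasPeriod_ : (ℕ → ℕ) → ℕ → Set
  f HasPeriod p = ∀ m → 1 ℕ.≤ m → f (m ℕ.+ p) ≡ f m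

  module _ {f : ℕ → ℕ} where

    period-0 : f HasPeriod 0
    period-0 m _ = cong f (ℕₚ.+-identityʳ m)

    period-+ : ∀ {a b} → f HasPeriod a → f HasPeriod b → f HasPeriod (a ℕ.+ b)
    period-+ {a} {b} per-a per-b m 1≤m =
      trans (cong f (sym (ℕₚ.+-assoc m a b))) (trans (per-b (m ℕ.+ a) (ℕₚ.≤-trans 1≤m (ℕₚ.m≤m+n m a))) (per-a m 1≤m))

    period-* : ∀ {a} u → f HasPeriod a → f HasPeriod (u ℕ.* a)
    period-* zero per-a = period-0
    period-* (suc u) per-a = period-+ per-a (period-* u per-a)

    period-∣ : ∀ {d x} → f HasPeriod d → d ∣ x → f HasPeriod x
    period-∣ per-d (divides u refl) = period-* u per-d

    period-cancelˡ : ∀ {b d} → f HasPeriod (b ℕ.+ d) → f HasPeriod b → f HasPeriod d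
    period-cancelˡ {b} {d} per-b+d per-b m 1≤m =
      trans (sym (per-b (m ℕ.+ d) (ℕₚ.≤-trans 1≤m (ℕₚ.m≤m+n m d))))
            (trans (cong f (trans (ℕₚ.+-assoc m d b) (cong (m ℕ.+_) (ℕₚ.+-comm d b)))) (per-b+d m 1≤m))

    period-gcd : ∀ r s → f HasPeriod r → f HasPeriod s → ∃[ d ] GCD r s d × f HasPeriod d
    period-gcd r s per-r per-s with Bézout.lemma r s
    ... | Bézout.result d g (Bézout.+- x y eq) =
      d , g , period-cancelˡ (subst (f HasPeriod_) (trans (sym eq) (ℕₚ.+-comm d (y ℕ.* s))) (period-* x per-r)) (period-* y per-s)
    ... | Bézout.result d g (Bézout.-+ x y eq) =
      d , g , period-cancelˡ (subst (f HasPeriod_) (trans (sym eq) (ℕₚ.+-comm d (x ℕ.* r))) (period-* y per-s)) (period-* x per-r)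

  prime∤⇒coprime : ∀ {q d} → Prime q → ¬ (q ∣ d) → Coprime d q
  prime∤⇒coprime {q} {d} q-prime q∤d with prime⇒irreducible q-prime (gcd[m,n]∣n d q)
  ... | inj₁ gcd≡1 = gcd≡1⇒coprime gcd≡1
  ... | inj₂ gcd≡q = ⊥-elim (q∤d (subst (_∣ d) gcd≡q (gcd[m,n]∣m d q)))

  ∣prime^suc⇒∣prime^ : ∀ {q} → Prime q → ∀ e {d} → d ∣ q ℕ.^ suc e → ¬ (q ℕ.^ suc e ∣ d) → d ∣ q ℕ.^ e
  ∣prime^suc⇒∣prime^ {q} q-prime e {d} d∣q^[1+e] q^[1+e]∤d with q ∣? d
  ... | no q∤d = coprime-divisor (prime∤⇒coprime q-prime q∤d) d∣q^[1+e]
  ∣prime^suc⇒∣prime^ {q} q-prime zero {d} _ q∤d | yes q∣d = ⊥-elim (q∤d (subst (_∣ d) (sym (ℕₚ.*-identityʳ q)) q∣d))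
  ∣prime^suc⇒∣prime^ {q} q-prime (suc e) {d} d∣q^[2+e] q^[2+e]∤d | yes (divides d' refl) =
    subst (_∣ q ℕ.^ suc e) (ℕₚ.*-comm q d') (*-monoʳ-∣ q (∣prime^suc⇒∣prime^ q-prime e d'∣q^[1+e] q^[1+e]∤d'))
    where
    instance _ = prime⇒nonZero q-prime
    d'∣q^[1+e] : d' ∣ q ℕ.^ suc e
    d'∣q^[1+e] = *-cancelʳ-∣ q (subst (d' ℕ.* q ∣_) (ℕₚ.*-comm q (q ℕ.^ suc e)) d∣q^[2+e])
    q^[1+e]∤d' : ¬ (q ℕ.^ suc e ∣ d')
    q^[1+e]∤d' h = q^[2+e]∤d (subst (q ℕ.* q ℕ.^ suc e ∣_) (ℕₚ.*-comm q d') (*-monoʳ-∣ q h))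

  -- gcd r q^(e+1) is again a period (Bézout), and unless q^(e+1) divides it, it divides q^e.
  least-period-prime-power : ∀ {f q} e → Prime q → f HasPeriod (q ℕ.^ suc e) → ¬ f HasPeriod (q ℕ.^ e) →
                             ∀ r → 1 ℕ.≤ r → f HasPeriod r → q ℕ.^ suc e ℕ.≤ r
  least-period-prime-power {f} {q} e q-prime per ¬per r 1≤r per-r with period-gcd r (q ℕ.^ suc e) per-r per
  ... | d , gcd , per-d with q ℕ.^ suc e ∣? d
  ... | yes q^[1+e]∣d = ∣⇒≤ {{ℕ.>-nonZero 1≤r}} (∣-trans q^[1+e]∣d (proj₁ (GCD.commonDivisor gcd)))
  ... | no q^[1+e]∤d = ⊥-elim (¬per (period-∣ per-d (∣prime^suc⇒∣prime^ q-prime e (proj₂ (GCD.commonDivisor gcd)) q^[1+e]∤d)))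

  prime∤⇒coprime-^ : ∀ {q c} → Prime q → ¬ (q ∣ c) → ∀ t → Coprime c (q ℕ.^ t)
  prime∤⇒coprime-^ {q} {c} q-prime q∤c t {i} (i∣c , i∣q^t) = ∣1⇒≡1 (divides-one t i∣q^t)
    where
    q∤i : ¬ (q ∣ i)
    q∤i q∣i = q∤c (∣-trans q∣i i∣c)
    divides-one : ∀ t → i ∣ q ℕ.^ t → i ∣ 1
    divides-one zero i∣1 = i∣1
    divides-one (suc t) i∣q^[1+t] = divides-one t (coprime-divisor (prime∤⇒coprime q-prime q∤i) i∣q^[1+t])

  -- Lifting the exponent

  binomial-linear : ∀ j x n → ∃[ c ] (j + x) ^ suc n ≡ j ^ suc n + + suc n * x * j ^ n + x * x * c
  binomial-linear j x zero = 0ℤ , lemma j x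
    where lemma : ∀ j x → (j + x) * 1ℤ ≡ j * 1ℤ + 1ℤ * x * 1ℤ + x * x * 0ℤ
          lemma = solve-∀
  binomial-linear j x (suc n) with binomial-linear j x n
  ... | c , eq = + suc n * j ^ n + c * j + x * c ,
    trans (cong ((j + x) *_) eq)
          (trans (lemma j x (j ^ n) c (+ n))
                 (cong (λ s → j * (j * j ^ n) + s * x * (j * j ^ n) + x * x * (+ suc n * j ^ n + c * j + x * c)) (sym (pos-+ 2 n))))
    where lemma : ∀ j x J c n → (j + x) * (j * J + (+ 1 + n) * x * J + x * x * c)
                                ≡ j * (j * J) + (+ 2 + n) * x * (j * J) + x * x * ((+ 1 + n) * J + c * j + x * c)
          lemma = solve-∀

  one-plus-^-quadratic : ∀ Z m → ∃[ G ] (1ℤ + Z) ^ m ≡ 1ℤ + + m * Z + triangle m * Z * Z + G * Z * Z * Z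
  one-plus-^-quadratic Z zero = 0ℤ , lemma Z
    where lemma : ∀ Z → 1ℤ ≡ 1ℤ + 0ℤ * Z + 0ℤ * Z * Z + 0ℤ * Z * Z * Z
          lemma = solve-∀
  one-plus-^-quadratic Z (suc m) with one-plus-^-quadratic Z m
  ... | G , eq = G + triangle m + G * Z ,
    trans (cong ((1ℤ + Z) *_) eq)
          (trans (lemma Z (+ m) (triangle m) G) (cong (λ s → 1ℤ + s * Z + (triangle m + + m) * Z * Z + (G + triangle m + G * Z) * Z * Z * Z) (sym (pos-+ 1 m))))
    where lemma : ∀ Z m T G → (1ℤ + Z) * (1ℤ + m * Z + T * Z * Z + G * Z * Z * Z)
                              ≡ 1ℤ + (+ 1 + m) * Z + (T + m) * Z * Z + (G + T + G * Z) * Z * Z * Z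
          lemma = solve-∀

  one-plus-^-linear : ∀ Z m → ∃[ F ] (1ℤ + Z) ^ m ≡ 1ℤ + + m * Z + F * Z * Z
  one-plus-^-linear Z m with one-plus-^-quadratic Z m
  ... | G , eq = triangle m + G * Z , trans eq (lemma (+ m) Z (triangle m) G)
    where lemma : ∀ m Z T G → 1ℤ + m * Z + T * Z * Z + G * Z * Z * Z ≡ 1ℤ + m * Z + (T + G * Z) * Z * Z
          lemma = solve-∀

  private
    pow-mod : ∀ {q s x y} c → x ≡ y + c * (+ q) ^ s → x ≡ y mod q ℕ.^ s
    pow-mod {q} {s} {y = y} c eq = mod-witness c (trans eq (cong (λ z → y + c * z) (sym (pos-^ q s))))

  lift-mod-^-self : ∀ {q s x y} → x ≡ y mod q ℕ.^ suc s → x ^ q ≡ y ^ q mod q ℕ.^ suc (suc s)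
  lift-mod-^-self {zero} _ = mod-refl
  lift-mod-^-self {suc q'} {s} {x} {y} (mod-witness c eq) with binomial-linear y (c * (+ suc q') ^ suc s) q'
  ... | d , expansion = pow-mod {suc q'} {suc (suc s)} (c * y ^ q' + c * c * d * (+ suc q') ^ s)
    (trans (cong (_^ suc q') (trans eq (cong (λ z → y + c * z) (pos-^ (suc q') (suc s)))))
           (trans expansion (lemma y c d ((+ suc q') ^ s) (+ suc q') (y ^ q'))))
    where
    lemma : ∀ y c d P Q Y → y * Y + Q * (c * (Q * P)) * Y + (c * (Q * P)) * (c * (Q * P)) * d
                          ≡ y * Y + (c * Y + c * c * d * P) * (Q * (Q * P))
    lemma = solve-∀

  ^-*-assoc′ : ∀ x a b → x ^ (a ℕ.* b) ≡ (x ^ b) ^ a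
  ^-*-assoc′ x a b = trans (cong (x ^_) (ℕₚ.*-comm a b)) (sym (^-*-assoc x b a))

  lift-mod-^-prime-power : ∀ {q s x y} → x ≡ y mod q ℕ.^ suc s →
                           ∀ i → x ^ (q ℕ.^ i) ≡ y ^ (q ℕ.^ i) mod q ℕ.^ (suc s ℕ.+ i)
  lift-mod-^-prime-power {q} {s} {x} {y} x≡y zero
    rewrite ℕₚ.+-identityʳ s | ^-identityʳ x | ^-identityʳ y = x≡y
  lift-mod-^-prime-power {q} {s} {x} {y} x≡y (suc i)
    rewrite ℕₚ.+-suc s i | ^-*-assoc′ x q (q ℕ.^ i) | ^-*-assoc′ y q (q ℕ.^ i) =
    lift-mod-^-self {q} {s ℕ.+ i} (lift-mod-^-prime-power {q} {s} x≡y i)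

  lift-mod-^ : ∀ {q s x y i n} → q ℕ.^ i ∣ n → x ≡ y mod q ℕ.^ suc s → x ^ n ≡ y ^ n mod q ℕ.^ (suc s ℕ.+ i)
  lift-mod-^ {q} {s} {x} {y} {i} (divides m refl) x≡y
    rewrite ^-*-assoc′ x m (q ℕ.^ i) | ^-*-assoc′ y m (q ℕ.^ i) = mod-^ (lift-mod-^-prime-power {q} {s} x≡y i) m

  odd-^-step : ∀ h r u → let q = suc (h ℕ.+ h) in
    (1ℤ + (+ q) ^ suc r * u) ^ q ≡ 1ℤ + (+ q) ^ suc (suc r) * u mod q ℕ.^ suc (suc (suc r))
  odd-^-step h r u = begin
    (1ℤ + Z) ^ q                                          ≡⟨ proj₂ (one-plus-^-quadratic Z q) ⟩
    1ℤ + Q * Z + triangle q * Z * Z + G * Z * Z * Z   ≡⟨ cong (λ T → 1ℤ + Q * Z + T * Z * Z + G * Z * Z * Z) (triangle-odd h) ⟩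
    1ℤ + Q * Z + Q * + h * Z * Z + G * Z * Z * Z           ≈⟨ mod-+ (mod-+-≡0 {x = 1ℤ + Q * Z} quadratic≡0) cubic≡0 ⟩
    1ℤ + Q * Z + 0ℤ                                       ≡⟨ +-identityʳ _ ⟩
    1ℤ + Q * Z                                            ≡⟨ cong (_+_ 1ℤ) (sym (*-assoc Q (Q ^ suc r) u)) ⟩
    1ℤ + (+ q) ^ suc (suc r) * u                          ∎
    where
    open ModReasoning
    q = suc (h ℕ.+ h)
    Q = + q
    P = Q ^ r
    Z = Q ^ suc r * u
    G = proj₁ (one-plus-^-quadratic Z q)
    Q³P≡q^[r+3] : Q * (Q * (Q * P)) ≡ + (q ℕ.^ suc (suc (suc r)))
    Q³P≡q^[r+3] = sym (pos-^ q (suc (suc (suc r))))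
    quadratic≡0 : Q * + h * Z * Z ≡ 0ℤ mod q ℕ.^ suc (suc (suc r))
    quadratic≡0 = multiple≡0 (+ h * P * u * u) (trans (lemma Q (+ h) P u) (cong (+ h * P * u * u *_) Q³P≡q^[r+3]))
      where lemma : ∀ Q H P u → Q * H * (Q * P * u) * (Q * P * u) ≡ H * P * u * u * (Q * (Q * (Q * P)))
            lemma = solve-∀
    cubic≡0 : G * Z * Z * Z ≡ 0ℤ mod q ℕ.^ suc (suc (suc r))
    cubic≡0 = multiple≡0 (G * P * P * u * u * u) (trans (lemma G Q P u) (cong (G * P * P * u * u * u *_) Q³P≡q^[r+3]))
      where lemma : ∀ G Q P u → G * (Q * P * u) * (Q * P * u) * (Q * P * u) ≡ G * P * P * u * u * u * (Q * (Q * (Q * P)))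
            lemma = solve-∀

  odd-^-prime-power : ∀ h s i → let q = suc (h ℕ.+ h) in
    ∃[ u ] (1ℤ + (+ q) ^ suc s) ^ (q ℕ.^ i) ≡ 1ℤ + (+ q) ^ (suc s ℕ.+ i) * u × (u ≡ 1ℤ mod q)
  odd-^-prime-power h s zero = 1ℤ , lemma (+ suc (h ℕ.+ h)) s , mod-refl
    where lemma : ∀ Q s → (1ℤ + Q ^ suc s) ^ 1 ≡ 1ℤ + Q ^ (suc s ℕ.+ 0) * 1ℤ
          lemma Q s rewrite ℕₚ.+-identityʳ s = trans (^-identityʳ (1ℤ + Q ^ suc s)) (cong (_+_ 1ℤ) (sym (*-identityʳ (Q ^ suc s))))
  odd-^-prime-power h s (suc i) with odd-^-prime-power h s i
  ... | u , eq , u≡1 = u + k * Q , expansion , mod-trans (mod-witness k refl) u≡1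
    where
    q = suc (h ℕ.+ h)
    Q = + q
    e = s ℕ.+ i
    k = _≡_mod_.quotient (odd-^-step h e u)
    expansion : (1ℤ + Q ^ suc s) ^ (q ℕ.^ suc i) ≡ 1ℤ + Q ^ (suc s ℕ.+ suc i) * (u + k * Q)
    expansion = begin
      (1ℤ + Q ^ suc s) ^ (q ℕ.* q ℕ.^ i)               ≡⟨ ^-*-assoc′ _ q (q ℕ.^ i) ⟩
      ((1ℤ + Q ^ suc s) ^ (q ℕ.^ i)) ^ q               ≡⟨ cong (_^ q) eq ⟩
      (1ℤ + Q ^ suc e * u) ^ q                         ≡⟨ _≡_mod_.equation (odd-^-step h e u) ⟩
      1ℤ + Q ^ suc (suc e) * u + k * + (q ℕ.^ suc (suc (suc e)))
                                                       ≡⟨ cong (λ x → 1ℤ + Q ^ suc (suc e) * u + k * x) (pos-^ q (suc (suc (suc e)))) ⟩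
      1ℤ + Q ^ suc (suc e) * u + k * (Q * Q ^ suc (suc e))  ≡⟨ lemma Q (Q ^ suc (suc e)) u k ⟩
      1ℤ + Q ^ suc (suc e) * (u + k * Q)               ≡⟨ cong (λ x → 1ℤ + Q ^ suc x * (u + k * Q)) (sym (ℕₚ.+-suc s i)) ⟩
      1ℤ + Q ^ (suc s ℕ.+ suc i) * (u + k * Q)         ∎
      where
      open ≡-Reasoning
      lemma : ∀ Q X u k → 1ℤ + X * u + k * (Q * X) ≡ 1ℤ + X * (u + k * Q)
      lemma = solve-∀

  one-plus-^-≢1 : ∀ {q u m} e → Prime q → ¬ (q ∣ m) → u ≡ 1ℤ mod q →
                  ¬ ((1ℤ + (+ q) ^ suc e * u) ^ m ≡ 1ℤ mod q ℕ.^ suc (suc e))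
  one-plus-^-≢1 {q} {u} {m} e q-prime q∤m u≡1 power≡1 =
    [ q∤m , q∤u ]′ (euclidsLemma m ∣ u ∣ q-prime (subst (q ∣_) (abs-* (+ m) u) (mod≡0-cancelʳ (+ m * u) mu·q^[1+e]≡0)))
    where
    instance _ = ℕₚ.m^n≢0 q (suc e) {{prime⇒nonZero q-prime}}
    Q = + q
    Z = Q ^ suc e * u
    F = proj₁ (one-plus-^-linear Z m)
    M = q ℕ.^ suc (suc e)
    quadratic≡0 : F * Z * Z ≡ 0ℤ mod M
    quadratic≡0 = multiple≡0 (F * Q ^ e * u * u) (trans (lemma F Q (Q ^ e) u) (cong (F * Q ^ e * u * u *_) (sym (pos-^ q (suc (suc e))))))
      where lemma : ∀ F Q P u → F * (Q * P * u) * (Q * P * u) ≡ F * P * u * u * (Q * (Q * P))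
            lemma = solve-∀
    linear≡0 : + m * Z ≡ 0ℤ mod M
    linear≡0 = mod-cancelˡ-+ {a = 1ℤ} (begin
      1ℤ + + m * Z                 ≈⟨ mod-sym (mod-+-≡0 {x = 1ℤ + + m * Z} quadratic≡0) ⟩
      1ℤ + + m * Z + F * Z * Z     ≡⟨ sym (proj₂ (one-plus-^-linear Z m)) ⟩
      (1ℤ + Z) ^ m                 ≈⟨ power≡1 ⟩
      1ℤ                           ≡⟨ sym (+-identityʳ 1ℤ) ⟩
      1ℤ + 0ℤ                      ∎)
      where open ModReasoning
    mu·q^[1+e]≡0 : + m * u * + (q ℕ.^ suc e) ≡ 0ℤ mod q ℕ.* q ℕ.^ suc e
    mu·q^[1+e]≡0 = mod-trans (mod-reflexive (trans (cong (+ m * u *_) (pos-^ q (suc e))) (lemma (+ m) u (Q ^ suc e)))) linear≡0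
      where lemma : ∀ m u P → m * u * P ≡ m * (P * u)
            lemma = solve-∀
    q∤u : ¬ (q ∣ ∣ u ∣)
    q∤u q∣u = prime⇒1≢0 q-prime (mod-trans (mod-sym u≡1) (∣⇒mod≡0 q∣u))

  exact-lift-odd : ∀ h s i n → Prime (suc (h ℕ.+ h)) → let q = suc (h ℕ.+ h) in
    q ℕ.^ i ∣ n → ¬ (q ℕ.^ suc i ∣ n) → ¬ ((1ℤ + (+ q) ^ suc s) ^ n ≡ 1ℤ mod q ℕ.^ suc (suc s ℕ.+ i))
  exact-lift-odd h s i n q-prime (divides m refl) q^[1+i]∤n power≡1 with odd-^-prime-power h s i
  ... | u , eq , u≡1 = one-plus-^-≢1 (s ℕ.+ i) q-prime q∤m u≡1 (subst (λ x → x ≡ 1ℤ mod q ℕ.^ suc (suc s ℕ.+ i)) regroup power≡1)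
    where
    q = suc (h ℕ.+ h)
    regroup : (1ℤ + (+ q) ^ suc s) ^ (m ℕ.* q ℕ.^ i) ≡ (1ℤ + (+ q) ^ (suc s ℕ.+ i) * u) ^ m
    regroup = trans (^-*-assoc′ (1ℤ + (+ q) ^ suc s) m (q ℕ.^ i)) (cong (_^ m) eq)
    q∤m : ¬ (q ∣ m)
    q∤m q∣m = q^[1+i]∤n (*-monoˡ-∣ (q ℕ.^ i) q∣m)

  exact-lift-two : ∀ s n → ¬ (2 ∣ n) → ¬ ((1ℤ + (+ 2) ^ suc s) ^ n ≡ 1ℤ mod 2 ℕ.^ suc (suc s))
  exact-lift-two s n 2∤n power≡1 =
    one-plus-^-≢1 s prime[2] 2∤n mod-refl (subst (λ x → (1ℤ + x) ^ n ≡ 1ℤ mod 2 ℕ.^ suc (suc s)) (sym (*-identityʳ ((+ 2) ^ suc s))) power≡1)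

  private
    block-term : ∀ n N w j → (+ (w ℕ.* N ℕ.+ j)) ^ suc n ≡ (+ j) ^ suc n + + suc n * + N * + w * (+ j) ^ n mod N ℕ.* N
    block-term n N w j with binomial-linear (+ j) (+ w * + N) n
    ... | c , expansion = mod-witness (c * + w * + w)
      (trans (cong (_^ suc n) w*N+j≡j+w*N)
      (trans expansion
      (trans (lemma ((+ j) ^ suc n) (+ suc n) (+ w) (+ N) ((+ j) ^ n) c)
             (cong (λ z → (+ j) ^ suc n + + suc n * + N * + w * (+ j) ^ n + c * + w * + w * z) (sym (pos-* N N))))))
      where
      w*N+j≡j+w*N : + (w ℕ.* N ℕ.+ j) ≡ + j + + w * + N
      w*N+j≡j+w*N = trans (pos-+ (w ℕ.* N) j) (trans (+-comm (+ (w ℕ.* N)) (+ j)) (cong (_+_ (+ j)) (pos-* w N)))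
      lemma : ∀ J S w N J' c → J + S * (w * N) * J' + (w * N) * (w * N) * c ≡ J + S * N * w * J' + c * w * w * (N * N)
      lemma = solve-∀

  -- Power sums over prime-power ranges

  -- Splitting [0, qN) into q blocks of length N and expanding each (wN + j)^(n+1) to first order in wN.
  powerSum-blocks : ∀ q N n → powerSum (suc n) (q ℕ.* N)
    ≡ + q * powerSum (suc n) N + + suc n * + N * triangle q * powerSum n N mod N ℕ.* N
  powerSum-blocks q N n =
    mod-trans (mod-reflexive (Σ<-blocks q N (λ j → (+ j) ^ suc n)))
    (mod-trans (Σ<-mod q (λ w → Σ<-mod N (block-term n N w)))
               (mod-reflexive collect))
    where
    A = powerSum (suc n) N
    B = powerSum n N
    C : ℕ → ℤ
    C w = + suc n * + N * + w
    collect : Σ< q (λ w → Σ< N (λ j → (+ j) ^ suc n + C w * (+ j) ^ n)) ≡ + q * A + + suc n * + N * triangle q * B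
    collect = begin
      Σ< q (λ w → Σ< N (λ j → (+ j) ^ suc n + C w * (+ j) ^ n))
        ≡⟨ Σ<-cong q (λ w → trans (Σ<-+ N _ _) (cong (_+_ A) (Σ<-*ˡ N (C w) (λ j → (+ j) ^ n)))) ⟩
      Σ< q (λ w → A + C w * B)
        ≡⟨ Σ<-+ q (λ _ → A) (λ w → C w * B) ⟩
      Σ< q (λ _ → A) + Σ< q (λ w → C w * B)
        ≡⟨ cong₂ _+_ (Σ<-const q A) (Σ<-cong q (λ w → lemma₁ (+ suc n * + N) (+ w) B)) ⟩
      + q * A + Σ< q (λ w → + suc n * + N * B * + w)
        ≡⟨ cong (_+_ (+ q * A)) (trans (Σ<-*ˡ q (+ suc n * + N * B) (λ w → + w)) (lemma₂ (+ suc n * + N) B (triangle q))) ⟩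
      + q * A + + suc n * + N * triangle q * B
        ∎
      where
      open ≡-Reasoning
      lemma₁ : ∀ c w b → c * w * b ≡ c * b * w
      lemma₁ = solve-∀
      lemma₂ : ∀ c b t → c * b * t ≡ c * t * b
      lemma₂ = solve-∀

  powerSum-scale : ∀ q N n → q ℕ.* N ∣ N ℕ.* N →
    + suc n * + N * triangle q * powerSum n N ≡ 0ℤ mod q ℕ.* N →
    powerSum (suc n) (q ℕ.* N) ≡ + q * powerSum (suc n) N mod q ℕ.* N
  powerSum-scale q N n qN∣N² correction≡0 = mod-trans (mod-∣ qN∣N² (powerSum-blocks q N n)) (mod-+-≡0 correction≡0)

  private
    N²-factor : ∀ q t → q ℕ.* q ℕ.^ suc t ∣ q ℕ.^ suc t ℕ.* q ℕ.^ suc t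
    N²-factor q t = divides (q ℕ.^ t) (lemma q (q ℕ.^ t))
      where lemma : ∀ q Q → q ℕ.* Q ℕ.* (q ℕ.* Q) ≡ Q ℕ.* (q ℕ.* (q ℕ.* Q))
            lemma = ℕ-Solver.solve-∀

  powerSum-odd-prime-power : ∀ h n t → let q = suc (h ℕ.+ h) in
    powerSum (suc n) (q ℕ.^ suc t) ≡ + (q ℕ.^ t) * powerSum (suc n) q mod q ℕ.^ suc t
  powerSum-odd-prime-power h n zero =
    subst (λ N → powerSum (suc n) N ≡ + 1 * powerSum (suc n) (suc (h ℕ.+ h)) mod N) (sym (ℕₚ.*-identityʳ (suc (h ℕ.+ h))))
          (mod-reflexive (sym (*-identityˡ _)))
  powerSum-odd-prime-power h n (suc t) =
    mod-trans (powerSum-scale q N n (N²-factor q t) correction≡0)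
    (mod-trans (mod-scale q (powerSum-odd-prime-power h n t))
               (mod-reflexive (trans (sym (*-assoc (+ q) (+ (q ℕ.^ t)) _)) (cong (_* powerSum (suc n) q) (sym (pos-* q (q ℕ.^ t)))))))
    where
    q = suc (h ℕ.+ h)
    N = q ℕ.^ suc t
    correction≡0 : + suc n * + N * triangle q * powerSum n N ≡ 0ℤ mod q ℕ.* N
    correction≡0 = multiple≡0 (+ suc n * + h * powerSum n N)
      (trans (cong (λ T → + suc n * + N * T * powerSum n N) (triangle-odd h))
      (trans (lemma (+ suc n) (+ N) (+ q) (+ h) (powerSum n N)) (cong (+ suc n * + h * powerSum n N *_) (sym (pos-* q N)))))
      where lemma : ∀ s N q h B → s * N * (q * h) * B ≡ s * h * B * (q * N)
            lemma = solve-∀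

  powerSum-two-power-even : ∀ n m → suc n ≡ m ℕ.* 2 → ∀ t →
    powerSum (suc n) (2 ℕ.^ suc t) ≡ + (2 ℕ.^ t) mod 2 ℕ.^ suc t
  powerSum-two-power-even n m n+1≡2m zero = mod-reflexive (trans (+-identityˡ _) (^-zeroˡ (suc n)))
  powerSum-two-power-even n m n+1≡2m (suc t) =
    mod-trans (powerSum-scale 2 N n (N²-factor 2 t) correction≡0)
    (mod-trans (mod-scale 2 (powerSum-two-power-even n m n+1≡2m t)) (mod-reflexive (sym (pos-* 2 (2 ℕ.^ t)))))
    where
    N = 2 ℕ.^ suc t
    correction≡0 : + suc n * + N * triangle 2 * powerSum n N ≡ 0ℤ mod 2 ℕ.* N
    correction≡0 = multiple≡0 (+ m * powerSum n N)
      (trans (cong (λ s → + s * + N * + 1 * powerSum n N) n+1≡2m)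
      (trans (cong (λ s → s * + N * + 1 * powerSum n N) (pos-* m 2))
      (trans (lemma (+ m) (+ N) (powerSum n N)) (cong (+ m * powerSum n N *_) (sym (pos-* 2 N))))))
      where lemma : ∀ m N B → m * + 2 * N * + 1 * B ≡ m * B * (+ 2 * N)
            lemma = solve-∀

  powerSum-two-power-odd : ∀ n m → suc n ≡ m ℕ.* 2 → ∀ t →
    powerSum (suc (suc n)) (2 ℕ.^ suc (suc t)) ≡ 0ℤ mod 2 ℕ.^ suc (suc t)
  powerSum-two-power-odd n m n+1≡2m zero = mod-+ (mod-+ 0+1≡1 2^e≡0) 3^e≡-1
    where
    e = suc (suc n)
    0+1≡1 : 0ℤ + (+ 0) ^ e + (+ 1) ^ e ≡ 1ℤ mod 4
    0+1≡1 = mod-reflexive (trans (+-identityˡ ((+ 1) ^ e)) (^-zeroˡ e))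
    2^e≡0 : (+ 2) ^ e ≡ 0ℤ mod 4
    2^e≡0 = multiple≡0 ((+ 2) ^ n) (lemma ((+ 2) ^ n))
      where lemma : ∀ X → + 2 * (+ 2 * X) ≡ X * + 4
            lemma = solve-∀
    3^e≡-1 : (+ 3) ^ e ≡ - 1ℤ mod 4
    3^e≡-1 = mod-trans (mod-^ {4} {+ 3} { - 1ℤ} (mod-witness 1ℤ refl) e)
      (mod-reflexive (cong ((- 1ℤ) *_) (trans (cong ((- 1ℤ) ^_) n+1≡2m) (trans (^-*-assoc′ (- 1ℤ) m 2) (^-zeroˡ m)))))
  powerSum-two-power-odd n m n+1≡2m (suc t) =
    mod-trans (powerSum-scale 2 N (suc n) (N²-factor 2 (suc t)) correction≡0)
    (mod-trans (mod-scale 2 (powerSum-two-power-odd n m n+1≡2m t)) (mod-reflexive (*-zeroʳ (+ 2))))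
    where
    N = 2 ℕ.^ suc (suc t)
    P = (+ 2) ^ t
    c = _≡_mod_.quotient (powerSum-two-power-even n m n+1≡2m (suc t))
    even-sum : powerSum (suc n) N ≡ + 2 * P + c * (+ 2 * (+ 2 * P))
    even-sum = trans (_≡_mod_.equation (powerSum-two-power-even n m n+1≡2m (suc t)))
                     (cong₂ (λ a b → a + c * b) (pos-^ 2 (suc t)) (pos-^ 2 (suc (suc t))))
    correction≡0 : + suc (suc n) * + N * triangle 2 * powerSum (suc n) N ≡ 0ℤ mod 2 ℕ.* N
    correction≡0 = multiple≡0 (+ suc (suc n) * (P + c * + 2 * P))
      (trans (cong₂ (λ x y → + suc (suc n) * x * + 1 * y) (pos-^ 2 (suc (suc t))) even-sum)
      (trans (lemma (+ suc (suc n)) P c)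
             (cong (+ suc (suc n) * (P + c * + 2 * P) *_) (sym (trans (pos-* 2 N) (cong (_*_ (+ 2)) (pos-^ 2 (suc (suc t)))))))))
      where lemma : ∀ s P c → s * (+ 2 * (+ 2 * P)) * + 1 * (+ 2 * P + c * (+ 2 * (+ 2 * P)))
                            ≡ s * (P + c * + 2 * P) * (+ 2 * (+ 2 * (+ 2 * P)))
            lemma = solve-∀

  -- Binomial coefficients and Fermat's little theorem

  suc-*-C : ∀ n k → suc k ℕ.* (suc n C suc k) ≡ suc n ℕ.* (n C k)
  suc-*-C zero zero = refl
  suc-*-C zero (suc k) = ℕₚ.*-zeroʳ (suc (suc k))
  suc-*-C (suc n) zero = trans (ℕₚ.*-identityˡ (suc (suc n) C 1)) (trans (nC1≡n (suc (suc n))) (sym (ℕₚ.*-identityʳ (suc (suc n)))))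
  suc-*-C (suc n) (suc k) = begin
    suc (suc k) ℕ.* (suc (suc n) C suc (suc k))
      ≡⟨ cong (suc (suc k) ℕ.*_) (sym (nCk+nC[k+1]≡[n+1]C[k+1] (suc n) (suc k))) ⟩
    suc (suc k) ℕ.* (suc n C suc k ℕ.+ suc n C suc (suc k))
      ≡⟨ lemma (suc k) (suc n C suc k) (suc n C suc (suc k)) ⟩
    suc k ℕ.* (suc n C suc k) ℕ.+ suc n C suc k ℕ.+ suc (suc k) ℕ.* (suc n C suc (suc k))
      ≡⟨ cong₂ (λ a b → a ℕ.+ suc n C suc k ℕ.+ b) (suc-*-C n k) (suc-*-C n (suc k)) ⟩
    suc n ℕ.* (n C k) ℕ.+ suc n C suc k ℕ.+ suc n ℕ.* (n C suc k)
      ≡⟨ lemma′ (suc n) (n C k) (n C suc k) (suc n C suc k) ⟩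
    suc n ℕ.* (n C k ℕ.+ n C suc k) ℕ.+ suc n C suc k
      ≡⟨ cong (λ c → suc n ℕ.* c ℕ.+ suc n C suc k) (nCk+nC[k+1]≡[n+1]C[k+1] n k) ⟩
    suc n ℕ.* (suc n C suc k) ℕ.+ suc n C suc k
      ≡⟨ ℕₚ.+-comm (suc n ℕ.* (suc n C suc k)) (suc n C suc k) ⟩
    suc (suc n) ℕ.* (suc n C suc k)
      ∎
    where
    open ≡-Reasoning
    lemma : ∀ k a b → suc k ℕ.* (a ℕ.+ b) ≡ k ℕ.* a ℕ.+ a ℕ.+ suc k ℕ.* b
    lemma = ℕ-Solver.solve-∀
    lemma′ : ∀ n a b c → n ℕ.* a ℕ.+ c ℕ.+ n ℕ.* b ≡ n ℕ.* (a ℕ.+ b) ℕ.+ c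
    lemma′ = ℕ-Solver.solve-∀

  prime∣C : ∀ {q} → Prime q → ∀ k → suc k ℕ.< q → q ∣ q C suc k
  prime∣C {zero} (prime {{()}} _) k k+1<q
  prime∣C {suc n} q-prime k k+1<q with euclidsLemma (suc k) (suc n C suc k) q-prime (divides (n C k) (trans (suc-*-C n k) (ℕₚ.*-comm (suc n) (n C k))))
  ... | inj₁ q∣k+1 = ⊥-elim (>⇒∤ k+1<q q∣k+1)
  ... | inj₂ q∣C = q∣C

  binomial : ∀ x n → (1ℤ + x) ^ n ≡ Σ< (suc n) (λ k → + (n C k) * x ^ k)
  binomial x zero = lemma x
    where lemma : ∀ x → 1ℤ ≡ 0ℤ + + 1 * 1ℤ
          lemma = solve-∀
  binomial x (suc n) = sym (begin
    Σ< (suc (suc n)) (term (suc n))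
      ≡⟨ Σ<-suc (suc n) (term (suc n)) ⟩
    + 1 * 1ℤ + Σ< (suc n) (λ k → term (suc n) (suc k))
      ≡⟨ cong (_+_ (+ 1 * 1ℤ)) (trans (Σ<-cong (suc n) pascal) (Σ<-+ (suc n) (λ k → x * term n k) (λ k → term n (suc k)))) ⟩
    + 1 * 1ℤ + (Σ< (suc n) (λ k → x * term n k) + (R + term n (suc n)))
      ≡⟨ cong₂ (λ a b → + 1 * 1ℤ + (a + (R + b))) (Σ<-*ˡ (suc n) x (term n)) top≡0 ⟩
    + 1 * 1ℤ + (x * Σ< (suc n) (term n) + (R + 0ℤ))
      ≡⟨ cong (λ B → + 1 * 1ℤ + (x * B + (R + 0ℤ))) B≡1+R ⟩
    + 1 * 1ℤ + (x * (+ 1 * 1ℤ + R) + (R + 0ℤ))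
      ≡⟨ lemma x R ⟩
    (1ℤ + x) * (+ 1 * 1ℤ + R)
      ≡⟨ cong ((1ℤ + x) *_) (sym (trans (binomial x n) B≡1+R)) ⟩
    (1ℤ + x) ^ suc n
      ∎)
    where
    open ≡-Reasoning
    term : ℕ → ℕ → ℤ
    term m k = + (m C k) * x ^ k
    R = Σ< n (λ k → term n (suc k))
    B≡1+R : Σ< (suc n) (term n) ≡ + 1 * 1ℤ + R
    B≡1+R = Σ<-suc n (term n)
    pascal : ∀ k → term (suc n) (suc k) ≡ x * term n k + term n (suc k)
    pascal k = trans (cong (λ c → + c * x ^ suc k) (sym (nCk+nC[k+1]≡[n+1]C[k+1] n k)))
                     (trans (cong (_* x ^ suc k) (pos-+ (n C k) (n C suc k))) (distrib (+ (n C k)) (+ (n C suc k)) x (x ^ k)))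
      where distrib : ∀ a b x X → (a + b) * (x * X) ≡ x * (a * X) + b * (x * X)
            distrib = solve-∀
    top≡0 : term n (suc n) ≡ 0ℤ
    top≡0 = trans (cong (λ c → + c * x ^ suc n) (k>n⇒nCk≡0 (ℕₚ.n<1+n n))) (*-zeroˡ (x ^ suc n))
    lemma : ∀ x R → + 1 * 1ℤ + (x * (+ 1 * 1ℤ + R) + (R + 0ℤ)) ≡ (1ℤ + x) * (+ 1 * 1ℤ + R)
    lemma = solve-∀

  private
    prime∣C* : ∀ {q} → Prime q → ∀ k x → suc k ℕ.< q → + (q C suc k) * x ≡ 0ℤ mod q
    prime∣C* {q} q-prime k x k+1<q =
      mod-trans (mod-* (∣⇒mod≡0 {x = + (q C suc k)} (prime∣C q-prime k k+1<q)) (mod-refl {x = x})) (mod-reflexive (*-zeroˡ x))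

  freshmans-dream : ∀ {q} → Prime q → ∀ x → (1ℤ + x) ^ q ≡ 1ℤ + x ^ q mod q
  freshmans-dream {zero} (prime {{()}} _) x
  freshmans-dream {suc q'} q-prime x = mod-trans (mod-reflexive (trans (binomial x q) (Σ<-suc q _)))
    (mod-+ (mod-reflexive (*-identityʳ (+ 1)))
           (mod-trans (mod-+ (Σ<-mod-< q' (λ k k<q' → prime∣C* q-prime k (x ^ suc k) (s≤s k<q'))) top≡x^q)
                      (mod-reflexive (trans (cong (_+ x ^ q) (trans (Σ<-const q' 0ℤ) (*-zeroʳ (+ q')))) (+-identityˡ (x ^ q))))))
    where
    q = suc q'
    top≡x^q : + (q C q) * x ^ q ≡ x ^ q mod q
    top≡x^q = mod-reflexive (trans (cong (λ c → + c * x ^ q) (nCn≡1 q)) (*-identityˡ (x ^ q)))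

  fermat-little : ∀ {q} → Prime q → ∀ c → (+ c) ^ q ≡ + c mod q
  fermat-little {zero} (prime {{()}} _) c
  fermat-little {suc q'} q-prime zero = mod-reflexive (*-zeroˡ ((+ 0) ^ q'))
  fermat-little {suc q'} q-prime (suc c) = mod-trans (freshmans-dream q-prime (+ c)) (mod-+ (mod-refl {x = 1ℤ}) (fermat-little q-prime c))

  fermat : ∀ {q} → Prime q → ∀ c → ¬ (q ∣ c) → (+ c) ^ (q ℕ.∸ 1) ≡ 1ℤ mod q
  fermat {zero} (prime {{()}} _) c q∤c
  fermat {suc q'} q-prime c q∤c = mod-cancelˡ-* {c = + c} (prime∤⇒coprime q-prime q∤c)
    (mod-trans (fermat-little q-prime c) (mod-reflexive (sym (*-identityʳ (+ c)))))

  fermat-* : ∀ {q} → Prime q → ∀ c → ¬ (q ∣ c) → ∀ m → (+ c) ^ (m ℕ.* (q ℕ.∸ 1)) ≡ 1ℤ mod q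
  fermat-* {q} q-prime c q∤c m =
    mod-trans (mod-reflexive (^-*-assoc′ (+ c) m (q ℕ.∸ 1))) (mod-trans (mod-^ (fermat q-prime c q∤c) m) (mod-reflexive (^-zeroˡ m)))

  -- Summing (j+1)^(r+1) - j^(r+1) over j < q and expanding by the binomial theorem.
  private
    powerSum-recurrence : ∀ q r → Σ< (suc r) (λ k → + (suc r C k) * powerSum k q) ≡ (+ q) ^ suc r - 0ℤ
    powerSum-recurrence q r = begin
      Σ< (suc r) (λ k → + (suc r C k) * powerSum k q)
        ≡⟨ Σ<-cong (suc r) (λ k → sym (Σ<-*ˡ q (+ (suc r C k)) (λ j → (+ j) ^ k))) ⟩
      Σ< (suc r) (λ k → Σ< q (λ j → + (suc r C k) * (+ j) ^ k))
        ≡⟨ sym (Σ<-swap q (suc r) (λ j k → + (suc r C k) * (+ j) ^ k)) ⟩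
      Σ< q (λ j → Σ< (suc r) (λ k → + (suc r C k) * (+ j) ^ k))
        ≡⟨ Σ<-cong q difference ⟩
      Σ< q (λ j → (+ suc j) ^ suc r - (+ j) ^ suc r)
        ≡⟨ Σ<-telescope q (λ j → (+ j) ^ suc r) ⟩
      (+ q) ^ suc r - (+ 0) ^ suc r
        ≡⟨ cong (_-_ ((+ q) ^ suc r)) (*-zeroˡ ((+ 0) ^ r)) ⟩
      (+ q) ^ suc r - 0ℤ
        ∎
      where
      open ≡-Reasoning
      difference : ∀ j → Σ< (suc r) (λ k → + (suc r C k) * (+ j) ^ k) ≡ (+ suc j) ^ suc r - (+ j) ^ suc r
      difference j = trans (lemma T ((+ j) ^ suc r)) (cong (_- (+ j) ^ suc r) (sym expansion))
        where
        T = Σ< (suc r) (λ k → + (suc r C k) * (+ j) ^ k)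
        expansion : (+ suc j) ^ suc r ≡ T + + 1 * (+ j) ^ suc r
        expansion = trans (binomial (+ j) (suc r)) (cong (λ c → T + + c * (+ j) ^ suc r) (nCn≡1 (suc r)))
        lemma : ∀ S X → S ≡ S + + 1 * X - X
        lemma = solve-∀

    powerSums-below : ∀ {q} → Prime q → ∀ r → r ℕ.< q → ∀ k → k ℕ.< r → powerSum k q ≡ 0ℤ mod q
    powerSums-below q-prime (suc r) r+1<q k k<r+1 with ℕₚ.m<1+n⇒m<n∨m≡n k<r+1
    ... | inj₁ k<r = powerSums-below q-prime r (ℕₚ.<-trans (ℕₚ.n<1+n r) r+1<q) k k<r
    powerSums-below {q} q-prime (suc r) r+1<q .r _ | inj₂ refl = mod-cancelˡ-* {c = + suc r} coprime (begin
      + suc r * powerSum r q         ≡⟨ cong (λ c → + c * powerSum r q) (sym C≡r+1) ⟩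
      + (suc r C r) * powerSum r q   ≈⟨ top≡0 ⟩
      0ℤ                             ≡⟨ sym (*-zeroʳ (+ suc r)) ⟩
      + suc r * 0ℤ                   ∎)
      where
      open ModReasoning
      C≡r+1 : suc r C r ≡ suc r
      C≡r+1 = trans (nCk≡nC[n∸k] (ℕₚ.n≤1+n r)) (trans (cong (suc r C_) (ℕₚ.m+n∸n≡m 1 r)) (nC1≡n (suc r)))
      coprime : Coprime (suc r) q
      coprime = prime∤⇒coprime q-prime (>⇒∤ r+1<q)
      f : ℕ → ℤ
      f k = + (suc r C k) * powerSum k q
      lower≡0 : Σ< r f ≡ 0ℤ mod q
      lower≡0 = mod-trans (Σ<-mod-< r (λ k k<r → mod-trans (mod-* (mod-refl {x = + (suc r C k)}) (powerSums-below q-prime r r<q k k<r))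
                                                           (mod-reflexive (*-zeroʳ (+ (suc r C k))))))
                          (mod-reflexive (trans (Σ<-const r 0ℤ) (*-zeroʳ (+ r))))
        where r<q = ℕₚ.<-trans (ℕₚ.n<1+n r) r+1<q
      q^[r+1]≡0 : (+ q) ^ suc r - 0ℤ ≡ 0ℤ mod q
      q^[r+1]≡0 = multiple≡0 ((+ q) ^ r) (trans (+-identityʳ _) (*-comm (+ q) ((+ q) ^ r)))
      top≡0 : f r ≡ 0ℤ mod q
      top≡0 = mod-trans (mod-reflexive (sym (+-identityˡ (f r))))
                (mod-trans (mod-sym (mod-+ lower≡0 (mod-refl {x = f r})))
                           (mod-trans (mod-reflexive (powerSum-recurrence q r)) q^[r+1]≡0))

  powerSum-prime≡0 : ∀ {q} → Prime q → ∀ r → suc r ℕ.< q → powerSum r q ≡ 0ℤ mod q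
  powerSum-prime≡0 q-prime r r+1<q = powerSums-below q-prime (suc r) r+1<q r ℕₚ.≤-refl

  -- Reindexing by a unit

  module _ (N : ℕ) .{{_ : NonZero N}} where

    modular-inverse : ∀ c → Coprime c N → ∃[ c' ] (c' ℕ.* c) % N ≡ 1 % N
    modular-inverse c coprime with coprime-Bézout coprime
    ... | Bézout.+- x y 1+yN≡xc = x , trans (cong (_% N) (sym 1+yN≡xc)) ([m+kn]%n≡m%n 1 y N)
    ... | Bézout.-+ x y 1+xc≡yN = (N ℕ.∸ 1) ℕ.* x , mod⇒%≡% N _ 1 inverse
      where
      N-1+1≡N : + (N ℕ.∸ 1) + 1ℤ ≡ + N
      N-1+1≡N = trans (sym (pos-+ (N ℕ.∸ 1) 1)) (cong +_ (ℕₚ.m∸n+n≡m (ℕ.>-nonZero⁻¹ N)))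
      xc≡yN-1 : + x * + c ≡ + y * + N - 1ℤ
      xc≡yN-1 = trans (lemma (+ x * + c)) (cong (_- 1ℤ) (trans (cong (_+_ 1ℤ) (sym (pos-* x c)))
                        (trans (sym (pos-+ 1 (x ℕ.* c))) (trans (cong +_ 1+xc≡yN) (pos-* y N)))))
        where lemma : ∀ z → z ≡ 1ℤ + z - 1ℤ
              lemma = solve-∀
      inverse : + ((N ℕ.∸ 1) ℕ.* x ℕ.* c) ≡ 1ℤ mod N
      inverse = mod-witness (+ (N ℕ.∸ 1) * + y - 1ℤ) (begin
        + ((N ℕ.∸ 1) ℕ.* x ℕ.* c)                        ≡⟨ trans (pos-* ((N ℕ.∸ 1) ℕ.* x) c) (cong (_* + c) (pos-* (N ℕ.∸ 1) x)) ⟩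
        + (N ℕ.∸ 1) * + x * + c                           ≡⟨ *-assoc (+ (N ℕ.∸ 1)) (+ x) (+ c) ⟩
        + (N ℕ.∸ 1) * (+ x * + c)                         ≡⟨ cong (_*_ (+ (N ℕ.∸ 1))) xc≡yN-1 ⟩
        + (N ℕ.∸ 1) * (+ y * + N - 1ℤ)                    ≡⟨ cong (λ n → + (N ℕ.∸ 1) * (+ y * n - 1ℤ)) (sym N-1+1≡N) ⟩
        + (N ℕ.∸ 1) * (+ y * (+ (N ℕ.∸ 1) + 1ℤ) - 1ℤ)     ≡⟨ lemma (+ (N ℕ.∸ 1)) (+ y) ⟩
        1ℤ + (+ (N ℕ.∸ 1) * + y - 1ℤ) * (+ (N ℕ.∸ 1) + 1ℤ) ≡⟨ cong (λ n → 1ℤ + (+ (N ℕ.∸ 1) * + y - 1ℤ) * n) N-1+1≡N ⟩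
        1ℤ + (+ (N ℕ.∸ 1) * + y - 1ℤ) * + N               ∎)
        where
        open ≡-Reasoning
        lemma : ∀ m y → m * (y * (m + 1ℤ) - 1ℤ) ≡ 1ℤ + (m * y - 1ℤ) * (m + 1ℤ)
        lemma = solve-∀

    private
      multiply : ℕ → Fin N → Fin N
      multiply c i = fromℕ< (m%n<n (c ℕ.* toℕ i) N)

      multiply-inverse : ∀ c c' → (c' ℕ.* c) % N ≡ 1 % N → ∀ i → multiply c' (multiply c i) ≡ i
      multiply-inverse c c' c'c≡1 i = Finₚ.toℕ-injective (begin
        toℕ (multiply c' (multiply c i))          ≡⟨ Finₚ.toℕ-fromℕ< _ ⟩
        (c' ℕ.* toℕ (multiply c i)) % N           ≡⟨ cong (λ z → (c' ℕ.* z) % N) (Finₚ.toℕ-fromℕ< _) ⟩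
        (c' ℕ.* ((c ℕ.* toℕ i) % N)) % N          ≡⟨ %-distribˡ-* c' _ N ⟩
        (c' % N ℕ.* ((c ℕ.* toℕ i) % N % N)) % N  ≡⟨ cong (λ z → (c' % N ℕ.* z) % N) (m%n%n≡m%n (c ℕ.* toℕ i) N) ⟩
        (c' % N ℕ.* ((c ℕ.* toℕ i) % N)) % N      ≡⟨ sym (%-distribˡ-* c' (c ℕ.* toℕ i) N) ⟩
        (c' ℕ.* (c ℕ.* toℕ i)) % N                ≡⟨ cong (_% N) (sym (ℕₚ.*-assoc c' c (toℕ i))) ⟩
        (c' ℕ.* c ℕ.* toℕ i) % N                  ≡⟨ %-distribˡ-* (c' ℕ.* c) (toℕ i) N ⟩
        ((c' ℕ.* c) % N ℕ.* (toℕ i % N)) % N      ≡⟨ cong (λ z → (z ℕ.* (toℕ i % N)) % N) c'c≡1 ⟩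
        (1 % N ℕ.* (toℕ i % N)) % N               ≡⟨ sym (%-distribˡ-* 1 (toℕ i) N) ⟩
        (1 ℕ.* toℕ i) % N                         ≡⟨ cong (_% N) (ℕₚ.*-identityˡ (toℕ i)) ⟩
        toℕ i % N                                 ≡⟨ m<n⇒m%n≡m (Finₚ.toℕ<n i) ⟩
        toℕ i                                     ∎)
        where open ≡-Reasoning

      open CommutativeMonoidSum +-0-commutativeMonoid using (sum; ∑-permute; sum-cong-≗)

      Σ<≡sum : ∀ n (h : ℕ → ℤ) → Σ< n h ≡ sum {n} (λ i → h (toℕ i))
      Σ<≡sum zero h = refl
      Σ<≡sum (suc n) h = trans (Σ<-suc n h) (cong (_+_ (h 0)) (Σ<≡sum n (λ j → h (suc j))))

    Σ<-reindex-* : ∀ c → Coprime c N → ∀ h → Σ< N h ≡ Σ< N (λ j → h ((c ℕ.* j) % N))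
    Σ<-reindex-* c coprime h with modular-inverse c coprime
    ... | c' , c'c≡1 = begin
      Σ< N h                                       ≡⟨ Σ<≡sum N h ⟩
      sum {N} (λ i → h (toℕ i))                        ≡⟨ ∑-permute (λ i → h (toℕ i)) π ⟩
      sum {N} (λ i → h (toℕ (multiply c i)))           ≡⟨ sum-cong-≗ {N} (λ i → cong h (Finₚ.toℕ-fromℕ< _)) ⟩
      sum {N} (λ i → h ((c ℕ.* toℕ i) % N))            ≡⟨ sym (Σ<≡sum N (λ j → h ((c ℕ.* j) % N))) ⟩
      Σ< N (λ j → h ((c ℕ.* j) % N))               ∎
      where
      open ≡-Reasoning
      cc'≡1 : (c ℕ.* c') % N ≡ 1 % N
      cc'≡1 = trans (cong (_% N) (ℕₚ.*-comm c c')) c'c≡1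
      π : Permutation′ N
      π = permutation (multiply c) (multiply c') (multiply-inverse c' c cc'≡1) (multiply-inverse c c' c'c≡1)

  -- If every unit had c^n ≡ 1 then, for d = n mod (q - 1) with 0 < d < q - 1, Fermat would give
  -- powerSum d q ≡ q - 1, whereas it vanishes modulo q.
  nonresidue : ∀ {q} → Prime q → ∀ n → ¬ ((q ℕ.∸ 1) ∣ n) → ∃[ c ] ¬ (q ∣ c) × ¬ ((+ c) ^ n ≡ 1ℤ mod q)
  nonresidue {zero} (prime {{()}} _) n q-1∤n
  nonresidue {suc zero} (prime {{()}} _) n q-1∤n
  nonresidue {q@(suc q-1@(suc _))} q-prime n q-1∤n
    with ℕₚ.anyUpTo? (λ c → (1 ℕ.≤? c) ×-dec ¬? ((+ c) ^ n ≟ 1ℤ mod)) q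
  ... | yes (c , c<q , 1≤c , c^n≢1) = c , >⇒∤ {{ℕ.>-nonZero 1≤c}} c<q , c^n≢1
  ... | no none = ⊥-elim (ℕₚ.<⇒≱ (ℕₚ.n<1+n q-1) (∣⇒≤ (mod≡0⇒∣ {x = + q-1} q-1≡0)))
    where
    c^n≡1 : ∀ c → c ℕ.< q → 1 ℕ.≤ c → (+ c) ^ n ≡ 1ℤ mod q
    c^n≡1 c c<q 1≤c with (+ c) ^ n ≟ 1ℤ mod
    ... | yes c^n≡1 = c^n≡1
    ... | no c^n≢1 = ⊥-elim (none (c , c<q , 1≤c , c^n≢1))
    d = n % q-1
    d≢0 : d ≢ 0
    d≢0 d≡0 = q-1∤n (m%n≡0⇒n∣m n q-1 d≡0)
    c^d≡1 : ∀ c → c ℕ.< q → 1 ℕ.≤ c → (+ c) ^ d ≡ 1ℤ mod q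
    c^d≡1 c c<q 1≤c = begin
      (+ c) ^ d                                ≈⟨ mod-reflexive (sym (*-identityʳ _)) ⟩
      (+ c) ^ d * 1ℤ                           ≈⟨ mod-* (mod-refl {x = (+ c) ^ d}) (mod-sym c^multiple≡1) ⟩
      (+ c) ^ d * (+ c) ^ (n / q-1 ℕ.* q-1)    ≈⟨ mod-reflexive (sym (^-distribˡ-+-* (+ c) d _)) ⟩
      (+ c) ^ (d ℕ.+ n / q-1 ℕ.* q-1)          ≈⟨ mod-reflexive (cong ((+ c) ^_) (sym (m≡m%n+[m/n]*n n q-1))) ⟩
      (+ c) ^ n                                ≈⟨ c^n≡1 c c<q 1≤c ⟩
      1ℤ                                       ∎
      where
      open ModReasoning
      c^multiple≡1 : (+ c) ^ (n / q-1 ℕ.* q-1) ≡ 1ℤ mod q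
      c^multiple≡1 = fermat-* q-prime c (>⇒∤ {{ℕ.>-nonZero 1≤c}} c<q) (n / q-1)
    q-1≡0 : + q-1 ≡ 0ℤ mod q
    q-1≡0 = begin
      + q-1                              ≡⟨ sym (trans (Σ<-const q-1 1ℤ) (*-identityʳ (+ q-1))) ⟩
      Σ< q-1 (λ _ → 1ℤ)                  ≈⟨ mod-sym (Σ<-mod-< q-1 (λ j j<q-1 → c^d≡1 (suc j) (s≤s j<q-1) (s≤s z≤n))) ⟩
      Σ< q-1 (λ j → (+ suc j) ^ d)       ≡⟨ sym (powerSum-suc d q-1 d≢0) ⟩
      powerSum d q                       ≈⟨ powerSum-prime≡0 q-prime d (s≤s (m%n<n n q-1)) ⟩
      0ℤ                                 ∎
      where open ModReasoning

  -- Multiplying by a unit c with c^n ≢ 1 permutes the residues modulo q^(t+1) and scales the sum by c^n.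
  powerSum-prime-power≡0 : ∀ {q} → Prime q → ∀ n → ¬ ((q ℕ.∸ 1) ∣ n) → ∀ t i → q ℕ.^ i ∣ n →
                powerSum n (q ℕ.^ suc t) ≡ 0ℤ mod q ℕ.^ (suc t ℕ.+ i)
  powerSum-prime-power≡0 {q} q-prime n q-1∤n t i q^i∣n with nonresidue q-prime n q-1∤n
  ... | c , q∤c , c^n≢1 = mod-cancelˡ-* {c = Y - 1ℤ} coprime (begin
    (Y - 1ℤ) * P    ≡⟨ lemma Y P ⟩
    Y * P - P       ≈⟨ mod-difference (mod-sym P≡Y*P) ⟩
    0ℤ              ≡⟨ sym (*-zeroʳ (Y - 1ℤ)) ⟩
    (Y - 1ℤ) * 0ℤ   ∎)
    where
    open ModReasoning
    N = q ℕ.^ suc t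
    M = q ℕ.^ (suc t ℕ.+ i)
    instance _ = ℕₚ.m^n≢0 q (suc t) {{prime⇒nonZero q-prime}}
    G : ℕ → ℤ
    G j = (+ j) ^ n
    P = powerSum n N
    Y = (+ c) ^ n
    periodic : ∀ x → G (x ℕ.+ N) ≡ G x mod M
    periodic x = lift-mod-^ {q} {t} q^i∣n (mod-shift N x)
    multiply : ∀ j → G ((c ℕ.* j) % N) ≡ Y * G j mod M
    multiply j = begin
      G ((c ℕ.* j) % N)                          ≈⟨ mod-sym (periodic-* G periodic ((c ℕ.* j) / N) ((c ℕ.* j) % N)) ⟩
      G ((c ℕ.* j) % N ℕ.+ (c ℕ.* j) / N ℕ.* N)  ≡⟨ cong G (sym (m≡m%n+[m/n]*n (c ℕ.* j) N)) ⟩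
      G (c ℕ.* j)                                ≡⟨ trans (cong (_^ n) (pos-* c j)) (^-distribʳ-* (+ c) (+ j) n) ⟩
      Y * G j                                    ∎
    P≡Y*P : P ≡ Y * P mod M
    P≡Y*P = begin
      P                                  ≡⟨ Σ<-reindex-* N c (prime∤⇒coprime-^ q-prime q∤c (suc t)) G ⟩
      Σ< N (λ j → G ((c ℕ.* j) % N))     ≈⟨ Σ<-mod N multiply ⟩
      Σ< N (λ j → Y * G j)               ≡⟨ Σ<-*ˡ N Y G ⟩
      Y * P                              ∎
    coprime : Coprime ∣ Y - 1ℤ ∣ M
    coprime = prime∤⇒coprime-^ q-prime (λ q∣Y-1 → c^n≢1 (difference-mod (∣⇒mod≡0 q∣Y-1))) (suc t ℕ.+ i)
    lemma : ∀ Y P → (Y - 1ℤ) * P ≡ Y * P - P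
    lemma = solve-∀

  -- Periods of S n modulo k

  S≡Σ< : ∀ n m → + S n m ≡ Σ< m (λ j → (+ suc j) ^ n)
  S≡Σ< n zero = refl
  S≡Σ< n (suc m) = trans (pos-+ (S n m) (suc m ℕ.^ n)) (cong₂ _+_ (S≡Σ< n m) (pos-^ (suc m) n))

  window : ℕ → ℕ → ℕ → ℤ
  window n p m = Σ< p (λ j → (+ suc (m ℕ.+ j)) ^ n)

  S-+ : ∀ n m p → + S n (m ℕ.+ p) ≡ + S n m + window n p m
  S-+ n m p = trans (S≡Σ< n (m ℕ.+ p)) (trans (Σ<-split m p (λ j → (+ suc j) ^ n)) (cong (_+ window n p m) (sym (S≡Σ< n m))))

  S≡powerSum : ∀ {M} n N → (∀ x → (+ (x ℕ.+ N)) ^ n ≡ (+ x) ^ n mod M) → + S n N ≡ powerSum n N mod M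
  S≡powerSum n N periodic = mod-trans (mod-reflexive (S≡Σ< n N)) (window-sum-mod (λ x → (+ x) ^ n) periodic 1)

  S-mod : (k : ℕ) .{{_ : NonZero k}} → ℕ → ℕ → ℕ
  S-mod k n m = S n m % k

  powers-periodic : ∀ k n x → (+ (x ℕ.+ k)) ^ n ≡ (+ x) ^ n mod k
  powers-periodic k n x = mod-^ (mod-shift k x) n

  module _ (k : ℕ) .{{_ : NonZero k}} (n : ℕ) where

    window≡0⇒period : ∀ p → (∀ m → 1 ℕ.≤ m → window n p m ≡ 0ℤ mod k) → S-mod k n HasPeriod p
    window≡0⇒period p window≡0 m 1≤m =
      mod⇒%≡% k (S n (m ℕ.+ p)) (S n m) (mod-trans (mod-reflexive (S-+ n m p)) (mod-+-≡0 (window≡0 m 1≤m)))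

    period⇒window≡0 : ∀ p → S-mod k n HasPeriod p → ∀ m → 1 ℕ.≤ m → window n p m ≡ 0ℤ mod k
    period⇒window≡0 p per m 1≤m = mod-cancelˡ-+ {a = + S n m} (begin
      + S n m + window n p m   ≡⟨ sym (S-+ n m p) ⟩
      + S n (m ℕ.+ p)          ≈⟨ %≡%⇒mod k (S n (m ℕ.+ p)) (S n m) (per m 1≤m) ⟩
      + S n m                  ≡⟨ sym (+-identityʳ (+ S n m)) ⟩
      + S n m + 0ℤ             ∎)
      where open ModReasoning

    periodic-powers⇒period : ∀ p → (∀ x → (+ (x ℕ.+ p)) ^ n ≡ (+ x) ^ n mod k) → + S n p ≡ 0ℤ mod k → S-mod k n HasPeriod p
    periodic-powers⇒period p periodic S≡0 = window≡0⇒period p (λ m _ →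
      mod-trans (window-sum-mod (λ x → (+ suc x) ^ n) (λ x → periodic (suc x)) m)
                (mod-trans (mod-reflexive (sym (S≡Σ< n p))) S≡0))

    multiple-period : ∀ q → + q * + S n k ≡ 0ℤ mod k → S-mod k n HasPeriod (q ℕ.* k)
    multiple-period q qS≡0 = window≡0⇒period (q ℕ.* k) (λ m _ →
      mod-trans (window-sum-blocks (λ x → (+ suc x) ^ n) (λ x → powers-periodic k n (suc x)) q m)
                (mod-trans (mod-reflexive (cong (_*_ (+ q)) (sym (S≡Σ< n k)))) qS≡0))

    period-self⇒S≡0 : S-mod k n HasPeriod k → + S n k ≡ 0ℤ mod k
    period-self⇒S≡0 per = begin
      + S n k         ≡⟨ S≡Σ< n k ⟩
      Σ< k (λ j → (+ suc j) ^ n)  ≈⟨ mod-sym (window-sum-mod (λ x → (+ suc x) ^ n) (λ x → powers-periodic k n (suc x)) 1) ⟩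
      window n k 1    ≈⟨ period⇒window≡0 k per 1 (s≤s z≤n) ⟩
      0ℤ              ∎
      where open ModReasoning

    -- Comparing the windows starting at k and k + 1, which differ by (k + p + 1)^n - (k + 1)^n.
    period⇒one-plus-^≡1 : ∀ p → S-mod k n HasPeriod p → (+ (1 ℕ.+ p)) ^ n ≡ 1ℤ mod k
    period⇒one-plus-^≡1 p per = begin
      (+ (1 ℕ.+ p)) ^ n          ≈⟨ mod-sym (mod-^ (mod-trans (mod-reflexive (cong (λ x → + suc x) (ℕₚ.+-comm k p))) (mod-shift k (1 ℕ.+ p))) n) ⟩
      G (k ℕ.+ p)                ≈⟨ mod-sym shift ⟩
      G k                        ≈⟨ mod-^ (mod-shift k 1) n ⟩
      (+ 1) ^ n                  ≡⟨ ^-zeroˡ n ⟩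
      1ℤ                         ∎
      where
      open ModReasoning
      G : ℕ → ℤ
      G x = (+ suc x) ^ n
      shift : G k ≡ G (k ℕ.+ p) mod k
      shift = begin
        G k                                   ≡⟨ sym (+-identityʳ (G k)) ⟩
        G k + 0ℤ                              ≈⟨ mod-sym (mod-+ (mod-refl {x = G k}) (period⇒window≡0 p per (suc k) (s≤s z≤n))) ⟩
        G k + window n p (suc k)              ≡⟨ Σ<-window-step G k p ⟩
        window n p k + G (k ℕ.+ p)            ≈⟨ mod-+ (period⇒window≡0 p per k (ℕ.>-nonZero⁻¹ k)) (mod-refl {x = G (k ℕ.+ p)}) ⟩
        0ℤ + G (k ℕ.+ p)                      ≡⟨ +-identityˡ (G (k ℕ.+ p)) ⟩
        G (k ℕ.+ p)                           ∎

    period-one⇒2^n≡0 : S-mod k n HasPeriod 1 → (+ 2) ^ n ≡ 0ℤ mod k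
    period-one⇒2^n≡0 per = mod-trans (mod-reflexive (sym (+-identityˡ ((+ 2) ^ n)))) (period⇒window≡0 1 per 1 (s≤s z≤n))

    least-period : ∀ {q} e → Prime q → S-mod k n HasPeriod (q ℕ.^ suc e) → ¬ S-mod k n HasPeriod (q ℕ.^ e) → IsLeastPeriod k n (q ℕ.^ suc e)
    least-period {q} e q-prime per ¬per =
      (ℕ.>-nonZero⁻¹ (q ℕ.^ suc e) {{ℕₚ.m^n≢0 q (suc e) {{prime⇒nonZero q-prime}}}} , per) ,
      λ r per-r → least-period-prime-power e q-prime per ¬per r (proj₁ per-r) (proj₂ per-r)

    least-period-q*k : ∀ {q} a → Prime q → k ≡ q ℕ.^ suc a → + q * + S n k ≡ 0ℤ mod k → ¬ (+ S n k ≡ 0ℤ mod k) →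
                       IsLeastPeriod k n (q ℕ.^ suc (suc a))
    least-period-q*k {q} a q-prime refl qS≡0 S≢0 =
      least-period (suc a) q-prime (multiple-period q qS≡0) (λ per → S≢0 (period-self⇒S≡0 per))

  -- Least periods modulo 2, 2^a and q^a

  IsLeastPeriod-cong : ∀ {k k' n p p'} .{{_ : NonZero k}} .{{_ : NonZero k'}} → k ≡ k' → p ≡ p' →
                       IsLeastPeriod k n p → IsLeastPeriod k' n p'
  IsLeastPeriod-cong refl refl least = least

  parity : ∀ x → (2 ∣ x) ⊎ (2 ∣ suc x)
  parity zero = inj₁ (2 ∣0)
  parity (suc x) with parity x
  ... | inj₁ (divides m eq) = inj₂ (divides (suc m) (cong (λ y → suc (suc y)) eq))
  ... | inj₂ 2∣x+1 = inj₁ 2∣x+1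

  leastPeriod-2 : ∀ n → 1 ℕ.≤ n → IsLeastPeriod 2 n 4
  leastPeriod-2 n@(suc n-1) _ = least-period-q*k 2 n 0 prime[2] refl 2S≡0 S≢0
    where
    2S≡0 : + 2 * + S n 2 ≡ 0ℤ mod 2
    2S≡0 = multiple≡0 (+ S n 2) (*-comm (+ 2) (+ S n 2))
    S≡1+2X : + S n 2 ≡ 1ℤ + (+ 2) ^ n-1 * + 2
    S≡1+2X = trans (S≡Σ< n 2) (trans (cong (λ x → 0ℤ + x + (+ 2) ^ n) (^-zeroˡ n)) (lemma ((+ 2) ^ n-1)))
      where lemma : ∀ X → 0ℤ + 1ℤ + + 2 * X ≡ 1ℤ + X * + 2
            lemma = solve-∀
    S≢0 : ¬ (+ S n 2 ≡ 0ℤ mod 2)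
    S≢0 S≡0 = prime⇒1≢0 prime[2] (mod-trans (mod-sym (mod-witness ((+ 2) ^ n-1) S≡1+2X)) S≡0)

  S-one*2 : ∀ m → + S 1 m * + 2 ≡ + m * (+ m + 1ℤ)
  S-one*2 m = begin
    + S 1 m * + 2               ≡⟨ cong (_* + 2) (trans (S≡Σ< 1 m) (Σ<-cong m (λ j → ^-identityʳ (+ suc j)))) ⟩
    Σ< m (λ j → + suc j) * + 2  ≡⟨ cong (_* + 2) (sym (trans (Σ<-suc m (λ j → + j)) (+-identityˡ (Σ< m (λ j → + suc j))))) ⟩
    triangle (suc m) * + 2      ≡⟨ triangle*2 (suc m) ⟩
    + suc m * (+ suc m - 1ℤ)    ≡⟨ lemma (+ m) ⟩
    + m * (+ m + 1ℤ)            ∎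
    where
    open ≡-Reasoning
    lemma : ∀ m → (+ 1 + m) * (+ 1 + m - 1ℤ) ≡ m * (m + 1ℤ)
    lemma = solve-∀

  module _ (b : ℕ) .{{_ : NonZero (2 ℕ.^ suc (suc b))}} where

    private
      k : ℕ
      k = 2 ℕ.^ suc (suc b)
      2∣k : 2 ∣ k
      2∣k = divides (2 ℕ.^ suc b) (ℕₚ.*-comm 2 (2 ℕ.^ suc b))
      2∤1 : ¬ (2 ∣ 1)
      2∤1 = >⇒∤ (s≤s (s≤s z≤n))

    -- 2 S = k (k + 1) and k + 1 is odd.
    leastPeriod-2^a-one : IsLeastPeriod k 1 (2 ℕ.^ suc (suc (suc b)))
    leastPeriod-2^a-one = least-period-q*k k 1 (suc b) prime[2] refl 2S≡0 S≢0
      where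
      2S≡k[k+1] : + 2 * + S 1 k ≡ (+ k + 1ℤ) * + k
      2S≡k[k+1] = trans (*-comm (+ 2) (+ S 1 k)) (trans (S-one*2 k) (*-comm (+ k) (+ k + 1ℤ)))
      2S≡0 : + 2 * + S 1 k ≡ 0ℤ mod k
      2S≡0 = multiple≡0 (+ k + 1ℤ) 2S≡k[k+1]
      S≢0 : ¬ (+ S 1 k ≡ 0ℤ mod k)
      S≢0 S≡0 = 2∤1 (∣m+n∣m⇒∣n (subst (2 ∣_) (cong ∣_∣ (sym (pos-+ k 1))) 2∣k+1) 2∣k)
        where
        2∣k+1 : 2 ∣ ∣ + k + 1ℤ ∣
        2∣k+1 = mod≡0-cancelʳ (+ k + 1ℤ) (mod-trans (mod-reflexive (sym 2S≡k[k+1])) (mod-trans (mod-scale 2 S≡0) (mod-reflexive (*-zeroʳ (+ 2)))))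

    leastPeriod-2^a-even : ∀ n-1 m → suc n-1 ≡ m ℕ.* 2 → IsLeastPeriod k (suc n-1) (2 ℕ.^ suc (suc (suc b)))
    leastPeriod-2^a-even n-1 m n≡2m = least-period-q*k k n (suc b) prime[2] refl 2S≡0 S≢0
      where
      n = suc n-1
      S≡k/2 : + S n k ≡ + (2 ℕ.^ suc b) mod k
      S≡k/2 = mod-trans (S≡powerSum n k (powers-periodic k n)) (powerSum-two-power-even n-1 m n≡2m (suc b))
      2S≡0 : + 2 * + S n k ≡ 0ℤ mod k
      2S≡0 = mod-trans (mod-* (mod-refl {x = + 2}) S≡k/2) (multiple≡0 1ℤ (trans (sym (pos-* 2 (2 ℕ.^ suc b))) (sym (*-identityˡ (+ k)))))
      instance _ = ℕₚ.m^n≢0 2 (suc b)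
      S≢0 : ¬ (+ S n k ≡ 0ℤ mod k)
      S≢0 S≡0 = 2∤1 (mod≡0-cancelʳ {2} {2 ℕ.^ suc b} 1ℤ (mod-trans (mod-reflexive (*-identityˡ (+ (2 ℕ.^ suc b)))) (mod-trans (mod-sym S≡k/2) S≡0)))

    -- k is a period because S n k ≡ 0, and k/2 is not because (1 + k/2)^n ≢ 1 modulo k.
    leastPeriod-2^a-odd : ∀ n-1 m → suc n-1 ≡ m ℕ.* 2 → ¬ (2 ∣ suc (suc n-1)) → IsLeastPeriod k (suc (suc n-1)) k
    leastPeriod-2^a-odd n-1 m n-1≡2m 2∤n = least-period k n (suc b) prime[2] per ¬per
      where
      n = suc (suc n-1)
      per : S-mod k n HasPeriod k
      per = periodic-powers⇒period k n k (powers-periodic k n)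
              (mod-trans (S≡powerSum n k (powers-periodic k n)) (powerSum-two-power-odd n-1 m n-1≡2m b))
      ¬per : ¬ S-mod k n HasPeriod (2 ℕ.^ suc b)
      ¬per per′ = exact-lift-two b n 2∤n
        (mod-trans (mod-reflexive (cong (_^ n) (trans (cong (_+_ 1ℤ) (sym (pos-^ 2 (suc b)))) (sym (pos-+ 1 (2 ℕ.^ suc b))))))
                   (period⇒one-plus-^≡1 k n (2 ℕ.^ suc b) per′))

  leastPeriod-2^a : ∀ a n → 2 ℕ.≤ a → 1 ℕ.≤ n → .{{_ : NonZero (2 ℕ.^ a)}} →
    ((n ≡ 1 ⊎ (2 ∣ n)) → IsLeastPeriod (2 ℕ.^ a) n (2 ℕ.^ (a ℕ.+ 1)))
    × (¬ (n ≡ 1 ⊎ (2 ∣ n)) → IsLeastPeriod (2 ℕ.^ a) n (2 ℕ.^ a))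
  leastPeriod-2^a (suc (suc b)) (suc n-1) (s≤s (s≤s _)) _ = doubled , single n-1
    where
    k = 2 ℕ.^ suc (suc b)
    2^[a+1] : 2 ℕ.^ suc (suc (suc b)) ≡ 2 ℕ.^ (suc (suc b) ℕ.+ 1)
    2^[a+1] = cong (2 ℕ.^_) (ℕₚ.+-comm 1 (suc (suc b)))
    doubled : (suc n-1 ≡ 1 ⊎ (2 ∣ suc n-1)) → IsLeastPeriod k (suc n-1) (2 ℕ.^ (suc (suc b) ℕ.+ 1))
    doubled (inj₁ refl) = subst (IsLeastPeriod k 1) 2^[a+1] (leastPeriod-2^a-one b)
    doubled (inj₂ (divides m n≡2m)) = subst (IsLeastPeriod k (suc n-1)) 2^[a+1] (leastPeriod-2^a-even b n-1 m n≡2m)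
    single : ∀ n-1 → ¬ (suc n-1 ≡ 1 ⊎ (2 ∣ suc n-1)) → IsLeastPeriod k (suc n-1) k
    single zero n≢1∧2∤n = ⊥-elim (n≢1∧2∤n (inj₁ refl))
    single (suc n-2) n≢1∧2∤n with parity (suc n-2)
    ... | inj₁ (divides m n-1≡2m) = leastPeriod-2^a-odd b n-2 m n-1≡2m (λ 2∣n → n≢1∧2∤n (inj₂ 2∣n))
    ... | inj₂ 2∣n = ⊥-elim (n≢1∧2∤n (inj₂ 2∣n))

  prime∣^⇒∣ : ∀ {p m} → Prime p → ∀ n → p ∣ m ℕ.^ n → p ∣ m
  prime∣^⇒∣ p-prime zero p∣1 with ∣1⇒≡1 p∣1
  prime∣^⇒∣ (prime {{()}} _) zero p∣1 | refl
  prime∣^⇒∣ {m = m} p-prime (suc n) p∣m^[1+n] with euclidsLemma m (m ℕ.^ n) p-prime p∣m^[1+n]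
  ... | inj₁ p∣m = p∣m
  ... | inj₂ p∣m^n = prime∣^⇒∣ p-prime n p∣m^n

  odd⇒suc-double : ∀ q → ¬ (2 ∣ q) → ∃[ h ] q ≡ suc (h ℕ.+ h)
  odd⇒suc-double q 2∤q with parity q
  ... | inj₁ 2∣q = ⊥-elim (2∤q 2∣q)
  ... | inj₂ (divides zero ())
  ... | inj₂ (divides (suc h) q+1≡2h+2) = h , ℕₚ.suc-injective (trans q+1≡2h+2 (cong (λ x → suc (suc x)) (lemma h)))
    where lemma : ∀ h → h ℕ.* 2 ≡ h ℕ.+ h
          lemma = ℕ-Solver.solve-∀

  module _ (h : ℕ) (q-prime : Prime (suc (h ℕ.+ h))) where

    private
      q : ℕ
      q = suc (h ℕ.+ h)

    -- By Fermat S n q ≡ q - 1 modulo q, and the sum over q^(t+1) is q^t times the sum over q.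
    leastPeriod-q^a-fermat : ∀ t n-1 → .{{_ : NonZero (q ℕ.^ suc t)}} → (h ℕ.+ h) ∣ suc n-1 →
                             IsLeastPeriod (q ℕ.^ suc t) (suc n-1) (q ℕ.^ suc (suc t))
    leastPeriod-q^a-fermat t n-1 (divides m n≡m[q-1]) = least-period-q*k k n t q-prime refl qS≡0 S≢0
      where
      n = suc n-1
      k = q ℕ.^ suc t
      sum-q : powerSum n q ≡ + (h ℕ.+ h) mod q
      sum-q = begin
        powerSum n q                          ≡⟨ powerSum-suc n (h ℕ.+ h) (λ ()) ⟩
        Σ< (h ℕ.+ h) (λ j → (+ suc j) ^ n)    ≈⟨ Σ<-mod-< (h ℕ.+ h) unit^n≡1 ⟩
        Σ< (h ℕ.+ h) (λ _ → 1ℤ)               ≡⟨ trans (Σ<-const (h ℕ.+ h) 1ℤ) (*-identityʳ (+ (h ℕ.+ h))) ⟩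
        + (h ℕ.+ h)                           ∎
        where
        open ModReasoning
        unit^n≡1 : ∀ j → j ℕ.< h ℕ.+ h → (+ suc j) ^ n ≡ 1ℤ mod q
        unit^n≡1 j j<q-1 = subst (λ e → (+ suc j) ^ e ≡ 1ℤ mod q) (sym n≡m[q-1]) (fermat-* q-prime (suc j) (>⇒∤ (s≤s j<q-1)) m)
      S≡q^t[q-1] : + S n k ≡ + (q ℕ.^ t) * + (h ℕ.+ h) mod k
      S≡q^t[q-1] = begin
        + S n k                               ≈⟨ S≡powerSum n k (powers-periodic k n) ⟩
        powerSum n k                          ≈⟨ powerSum-odd-prime-power h n-1 t ⟩
        + (q ℕ.^ t) * powerSum n q            ≈⟨ mod-scaleʳ (q ℕ.^ t) sum-q ⟩
        + (q ℕ.^ t) * + (h ℕ.+ h)             ∎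
        where open ModReasoning
      qS≡0 : + q * + S n k ≡ 0ℤ mod k
      qS≡0 = mod-trans (mod-* (mod-refl {x = + q}) S≡q^t[q-1])
               (multiple≡0 (+ (h ℕ.+ h)) (trans (lemma (+ q) (+ (q ℕ.^ t)) (+ (h ℕ.+ h))) (cong (_*_ (+ (h ℕ.+ h))) (sym (pos-* q (q ℕ.^ t))))))
        where lemma : ∀ q Q H → q * (Q * H) ≡ H * (q * Q)
              lemma = solve-∀
      q∤q-1 : ∀ h → Prime (suc (h ℕ.+ h)) → ¬ (suc (h ℕ.+ h) ∣ h ℕ.+ h)
      q∤q-1 zero (prime {{()}} _)
      q∤q-1 (suc h) _ = >⇒∤ (ℕₚ.n<1+n _)
      S≢0 : ¬ (+ S n k ≡ 0ℤ mod k)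
      S≢0 S≡0 = q∤q-1 h q-prime (mod≡0-cancelʳ {q} {q ℕ.^ t} (+ (h ℕ.+ h))
                  (mod-trans (mod-reflexive (*-comm (+ (h ℕ.+ h)) (+ (q ℕ.^ t)))) (mod-trans (mod-sym S≡q^t[q-1]) S≡0)))
        where instance _ = ℕₚ.m^n≢0 q t

    leastPeriod-q^a-valuation : ∀ d i n → ¬ ((h ℕ.+ h) ∣ n) → q ℕ.^ i ∣ n → ¬ (q ℕ.^ suc i ∣ n) →
      .{{_ : NonZero (q ℕ.^ (suc (suc d) ℕ.+ i))}} → IsLeastPeriod (q ℕ.^ (suc (suc d) ℕ.+ i)) n (q ℕ.^ suc (suc d))
    leastPeriod-q^a-valuation d i n q-1∤n q^i∣n q^[1+i]∤n = least-period k n (suc d) q-prime per ¬per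
      where
      k = q ℕ.^ (suc (suc d) ℕ.+ i)
      p = q ℕ.^ suc (suc d)
      periodic : ∀ x → (+ (x ℕ.+ p)) ^ n ≡ (+ x) ^ n mod k
      periodic x = lift-mod-^ {q} {suc d} {i = i} q^i∣n (mod-shift p x)
      per : S-mod k n HasPeriod p
      per = periodic-powers⇒period k n p periodic (mod-trans (S≡powerSum n p periodic) (powerSum-prime-power≡0 q-prime n q-1∤n (suc d) i q^i∣n))
      ¬per : ¬ S-mod k n HasPeriod (q ℕ.^ suc d)
      ¬per per′ = exact-lift-odd h d i n q-prime q^i∣n q^[1+i]∤n
        (mod-trans (mod-reflexive (cong (_^ n) (trans (cong (_+_ 1ℤ) (sym (pos-^ q (suc d)))) (sym (pos-+ 1 (q ℕ.^ suc d))))))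
                   (period⇒one-plus-^≡1 k n (q ℕ.^ suc d) per′))

    leastPeriod-q^a-q : ∀ t n → ¬ ((h ℕ.+ h) ∣ n) → q ℕ.^ t ∣ n → .{{_ : NonZero (q ℕ.^ suc t)}} →
                        IsLeastPeriod (q ℕ.^ suc t) n q
    leastPeriod-q^a-q t n q-1∤n q^t∣n = subst (IsLeastPeriod k n) (ℕₚ.*-identityʳ q) (least-period k n 0 q-prime per ¬per)
      where
      k = q ℕ.^ suc t
      periodic : ∀ x → (+ (x ℕ.+ q ℕ.^ 1)) ^ n ≡ (+ x) ^ n mod k
      periodic x = lift-mod-^ {q} {0} {i = t} q^t∣n (mod-shift (q ℕ.^ 1) x)
      per : S-mod k n HasPeriod (q ℕ.^ 1)
      per = periodic-powers⇒period k n (q ℕ.^ 1) periodic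
              (mod-trans (S≡powerSum n (q ℕ.^ 1) periodic) (powerSum-prime-power≡0 q-prime n q-1∤n 0 t q^t∣n))
      q∤2 : ∀ h → Prime (suc (h ℕ.+ h)) → ¬ (suc (h ℕ.+ h) ∣ 2)
      q∤2 zero (prime {{()}} _)
      q∤2 (suc h) _ = >⇒∤ (s≤s (s≤s (ℕₚ.≤-trans (s≤s z≤n) (ℕₚ.m≤n+m (suc h) h))))
      ¬per : ¬ S-mod k n HasPeriod 1
      ¬per per′ = q∤2 h q-prime (prime∣^⇒∣ q-prime n
        (∣-trans (m∣m*n (q ℕ.^ t)) (subst (k ∣_) (cong ∣_∣ (sym (pos-^ 2 n))) (mod≡0⇒∣ (period-one⇒2^n≡0 k n per′)))))

  leastPeriod-q^a : ∀ q a n → Prime q → ¬ (2 ∣ q) → 1 ℕ.≤ a → 1 ℕ.≤ n → .{{_ : NonZero (q ℕ.^ a)}} →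
    ((q ℕ.∸ 1) ∣ n → IsLeastPeriod (q ℕ.^ a) n (q ℕ.^ (a ℕ.+ 1)))
    × (∀ i → ¬ ((q ℕ.∸ 1) ∣ n) → q ℕ.^ i ∣ n → ¬ (q ℕ.^ (i ℕ.+ 1) ∣ n) → i ℕ.+ 2 ℕ.≤ a →
        IsLeastPeriod (q ℕ.^ a) n (q ℕ.^ (a ℕ.∸ i)))
    × (¬ ((q ℕ.∸ 1) ∣ n) → q ℕ.^ (a ℕ.∸ 1) ∣ n → IsLeastPeriod (q ℕ.^ a) n q)
  leastPeriod-q^a q (suc t) (suc n-1) q-prime 2∤q _ _ with odd⇒suc-double q 2∤q
  ... | h , refl = fermat-case , valuation-case , q-case
    where
    a = suc t
    n = suc n-1
    fermat-case : (h ℕ.+ h) ∣ n → IsLeastPeriod (q ℕ.^ a) n (q ℕ.^ (a ℕ.+ 1))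
    fermat-case q-1∣n = subst (IsLeastPeriod (q ℕ.^ a) n) (cong (q ℕ.^_) (ℕₚ.+-comm 1 a)) (leastPeriod-q^a-fermat h q-prime t n-1 q-1∣n)
    valuation-case : ∀ i → ¬ ((h ℕ.+ h) ∣ n) → q ℕ.^ i ∣ n → ¬ (q ℕ.^ (i ℕ.+ 1) ∣ n) → i ℕ.+ 2 ℕ.≤ a →
                     IsLeastPeriod (q ℕ.^ a) n (q ℕ.^ (a ℕ.∸ i))
    valuation-case i q-1∤n q^i∣n q^[i+1]∤n i+2≤a with ℕₚ.m≤n⇒∃[o]m+o≡n i+2≤a
    ... | d , i+2+d≡a = IsLeastPeriod-cong (cong (q ℕ.^_) d+2+i≡a) (cong (q ℕ.^_) d+2≡a-i)
                          (leastPeriod-q^a-valuation h q-prime d i n q-1∤n q^i∣n q^[1+i]∤n)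
      where
      instance _ = ℕₚ.m^n≢0 q (suc (suc d) ℕ.+ i) {{prime⇒nonZero q-prime}}
      q^[1+i]∤n : ¬ (q ℕ.^ suc i ∣ n)
      q^[1+i]∤n = subst (λ e → ¬ (q ℕ.^ e ∣ n)) (ℕₚ.+-comm i 1) q^[i+1]∤n
      d+2+i≡a : suc (suc d) ℕ.+ i ≡ a
      d+2+i≡a = trans (lemma d i) i+2+d≡a
        where lemma : ∀ d i → suc (suc d) ℕ.+ i ≡ i ℕ.+ 2 ℕ.+ d
              lemma = ℕ-Solver.solve-∀
      d+2≡a-i : suc (suc d) ≡ a ℕ.∸ i
      d+2≡a-i = trans (sym (ℕₚ.m+n∸n≡m (suc (suc d)) i)) (cong (ℕ._∸ i) d+2+i≡a)
    q-case : ¬ ((h ℕ.+ h) ∣ n) → q ℕ.^ t ∣ n → IsLeastPeriod (q ℕ.^ a) n q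
    q-case q-1∤n q^t∣n = leastPeriod-q^a-q h q-prime t n q-1∤n q^t∣n

open import Data.Nat using (ℕ; _+_; _∸_; _^_; _≤_; NonZero)
open import Data.Nat.Divisibility using (_∣_)
open import Data.Nat.Primality using (Prime)
open import Data.Product using (_×_; _,_)
open import Data.Sum using (_⊎_)
open import Relation.Nullary using (¬_)
open import Relation.Binary.PropositionalEquality using (_≡_)
open import Defs
open PowerSumPeriods using (leastPeriod-2; leastPeriod-2^a; leastPeriod-q^a)

theorem9 : (∀ n → 1 ≤ n → IsLeastPeriod 2 n 4)
    × (∀ a n → 2 ≤ a → 1 ≤ n → .{{_ : NonZero (2 ^ a)}} →
        ((n ≡ 1 ⊎ 2 ∣ n) → IsLeastPeriod (2 ^ a) n (2 ^ (a + 1)))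
        × (¬ (n ≡ 1 ⊎ 2 ∣ n) → IsLeastPeriod (2 ^ a) n (2 ^ a)))
    × (∀ q a n → Prime q → ¬ (2 ∣ q) → 1 ≤ a → 1 ≤ n → .{{_ : NonZero (q ^ a)}} →
        ((q ∸ 1) ∣ n → IsLeastPeriod (q ^ a) n (q ^ (a + 1)))
        × (∀ i → ¬ ((q ∸ 1) ∣ n) → q ^ i ∣ n → ¬ (q ^ (i + 1) ∣ n) → i + 2 ≤ a →
            IsLeastPeriod (q ^ a) n (q ^ (a ∸ i)))
        × (¬ ((q ∸ 1) ∣ n) → q ^ (a ∸ 1) ∣ n → IsLeastPeriod (q ^ a) n q))
theorem9 = leastPeriod-2 , leastPeriod-2^a , leastPeriod-q^a
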